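{- The map $\zeta:\mathrm{NSym}\to\mathrm{NCSym}$ defined linearly by $\zeta(\mathbf{R}_\alpha)=M_\alpha$ for every composition $\alpha$ is an injective algebra homomorphism.
   Context: $\mathrm{NCSym}$ is realized as the algebra of formal series of bounded degree in noncommuting variables $x_1,x_2,x_3,\dots$ that are invariant under all permutations of the indices; it has basis $\mathbf{m}_A=\sum x_{i_1}\cdots x_{i_m}$ (sum over sequences of positive integers with $i_a=i_b$ iff $a,b$ lie in the same block of the set partition $A\vdash[m]$). For a composition $\alpha=(\alpha_1,\dots,\alpha_k)$, $M_\alpha=\sum x_{i_1}^{\alpha_1}x_{i_2}^{\alpha_2}\cdots x_{i_k}^{\alpha_k}$ summed over all sequences of positive integers $(i_1,\dots,i_k)$ with $i_j\ne i_{j+1}$ for $1\le j<k$ (non-adjacent indices may coincide); $M_\emptyset=1$. $\mathrm{NSym}=\mathbb{Q}\langle\mathbf{h}_1,\mathbf{h}_2,\dots\rangle$ is the free associative algebra, $\mathbf{h}_\beta=\mathbf{h}_{\beta_1}\cdots\mathbf{h}_{\beta_\ell}$, and the ribbon Schur functions are $\mathbf{R}_\alpha=\sum_\beta(-1)^{\ell(\alpha)-\ell(\beta)}\mathbf{h}_\beta$ over all compositions $\beta$ coarsening $\alpha$ (i.e. whose set of partial sums is contained in that of $\alpha$); they form a basis of $\mathrm{NSym}$. -}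

module Defs where

open import Data.Bool using (Bool; true; false; _∧_; not; if_then_else_; T)
open import Data.Nat as ℕ using (ℕ; zero; suc; _≤_; _<_; _∸_; _≡ᵇ_)
open import Data.List using (List; []; _∷_; map; length; foldr; take; drop)
open import Data.Bool.ListAction using (all; any)
open import Data.Nat.ListAction as NL using ()
import Data.List as L
open import Data.List.Relation.Unary.All using (All)
open import Data.List.Membership.Propositional using (_∈_)
open import Data.Maybe using (Maybe; just; nothing)
open import Data.Product using (_×_; _,_; Σ; ∃)
open import Data.Rational using (ℚ; 0ℚ; 1ℚ; _+_; _*_; -_)
open import Relation.Binary.PropositionalEquality using (_≡_)
open import Relation.Nullary using (¬_)
open import Function.Bundles using (_↔_; Inverse)

Word : Set
Word = List ℕ

IsComp : List ℕ → Set
IsComp α = All (λ k → 1 ≤ k) α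

isCompB : List ℕ → Bool
isCompB = all (λ k → not (k ≡ᵇ 0))

splits : Word → List (Word × Word)
splits [] = ([] , []) ∷ []
splits (a ∷ w) = ([] , a ∷ w) ∷ map (λ { (u , v) → (a ∷ u , v) }) (splits w)

sumℚ : List ℚ → ℚ
sumℚ = foldr _+_ 0ℚ

Coeffs : Set
Coeffs = Word → ℚ

_≈_ : Coeffs → Coeffs → Set
f ≈ g = ∀ w → f w ≡ g w
infix 4 _≈_

_⊕_ : Coeffs → Coeffs → Coeffs
(f ⊕ g) w = f w + g w
infixl 6 _⊕_

_·_ : ℚ → Coeffs → Coeffs
(c · f) w = c * f w
infixr 7 _·_

-- product of noncommutative series / polynomials: concatenation of words
-- extended bilinearly, (f ⋆ g)(w) = Σ_{w = u v} f(u) g(v)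
_⋆_ : Coeffs → Coeffs → Coeffs
(f ⋆ g) w = sumℚ (map (λ { (u , v) → f u * g v }) (splits w))
infixl 7 _⋆_

one : Coeffs
one [] = 1ℚ
one (_ ∷ _) = 0ℚ

-- NSym = ℚ⟨h₁,h₂,…⟩: a word β = (β₁,…,βℓ) (a composition) stands for the
-- monomial h_β = h_{β₁}⋯h_{βℓ}.

record NSym : Set where
  field
    coeff       : Coeffs
    support     : List Word
    supportComp : All IsComp support
    covers      : ∀ w → ¬ (coeff w ≡ 0ℚ) → w ∈ support
open NSym public

partialSums : List ℕ → List ℕ
partialSums α = go 0 α
  where
  go : ℕ → List ℕ → List ℕ
  go s [] = []
  go s (a ∷ as) = (s ℕ.+ a) ∷ go (s ℕ.+ a) as

memB : ℕ → List ℕ → Bool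
memB n = any (λ m → n ≡ᵇ m)

coarsensB : List ℕ → List ℕ → Bool
coarsensB α β = (NL.sum β ≡ᵇ NL.sum α) ∧ all (λ s → memB s (partialSums α)) (partialSums β)

sign : ℕ → ℚ
sign zero = 1ℚ
sign (suc n) = - sign n

-- coefficients of the ribbon Schur function R_α in the basis h_β:
-- R_α = Σ_{β coarsening α} (-1)^{ℓ(α)-ℓ(β)} h_β
Rcoeff : List ℕ → Coeffs
Rcoeff α β = if isCompB β ∧ coarsensB α β then sign (length α ∸ length β) else 0ℚ

-- Formal series in noncommuting variables x_i (i ∈ ℕ): a coefficient
-- function on words over ℕ; a word (i₁,…,im) is the monomial x_{i₁}⋯x_{im}.

Series : Set
Series = Coeffs

BoundedDegree : Series → Set
BoundedDegree f = ∃ λ d → ∀ w → d < length w → f w ≡ 0ℚ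

PermInvariant : Series → Set
PermInvariant f = ∀ (σ : ℕ ↔ ℕ) w → f (map (Inverse.to σ) w) ≡ f w

InNCSym : Series → Set
InNCSym f = BoundedDegree f × PermInvariant f

-- M_α = Σ x_{i₁}^{α₁}⋯x_{ik}^{αk} over (i₁,…,ik) with i_j ≠ i_{j+1}.
-- A word arises from at most one such index sequence, so the coefficient
-- of a word is 1 if it has that shape and 0 otherwise.

runOf : ℕ → Word → Maybe (ℕ × Word)
runOf zero w = nothing
runOf (suc n) [] = nothing
runOf (suc n) (i ∷ w) =
  if (length (take n w) ≡ᵇ n) ∧ all (λ j → j ≡ᵇ i) (take n w)
  then just (i , drop n w) else nothing

differs : Maybe ℕ → ℕ → Bool
differs nothing i = true
differs (just p) i = not (p ≡ᵇ i)

matchFrom : Maybe ℕ → List ℕ → Word → Bool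
matchFrom p [] [] = true
matchFrom p [] (_ ∷ _) = false
matchFrom p (a ∷ α) w with runOf a w
... | nothing = false
... | just (i , rest) = differs p i ∧ matchFrom (just i) α rest

M : List ℕ → Series
M α w = if matchFrom nothing α w then 1ℚ else 0ℚ

IsLinear : (NSym → Series) → Set
IsLinear ζ =
  (∀ x y z → coeff z ≈ coeff x ⊕ coeff y → ζ z ≈ ζ x ⊕ ζ y) ×
  (∀ c x z → coeff z ≈ c · coeff x → ζ z ≈ c · ζ x)

SendsRibbonToM : (NSym → Series) → Set
SendsRibbonToM ζ = ∀ α → IsComp α → ∀ r → coeff r ≈ Rcoeff α → ζ r ≈ M α

-- algebra homomorphism NSym → NCSym (linearity assumed separately)
IsAlgHomToNCSym : (NSym → Series) → Set
IsAlgHomToNCSym ζ =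
  (∀ x → InNCSym (ζ x)) ×
  (∀ u → coeff u ≈ one → ζ u ≈ one) ×
  (∀ x y z → coeff z ≈ coeff x ⋆ coeff y → ζ z ≈ ζ x ⋆ ζ y)

IsInjective : (NSym → Series) → Set
IsInjective ζ = ∀ x y → ζ x ≈ ζ y → coeff x ≈ coeff y

-- Let ζ₀ be the linear map sending h_β to p_{β₁}⋯p_{βℓ}, where p_b = M_{(b)} = ∑ᵢ xᵢ^b. Ribbons and
-- monomials obey the same Pieri rule, h_b R_α = R_{b·α} + R_{b⊙α} and p_b M_α = M_{b·α} + M_{b⊙α}
-- (b·α prepends b to α, b⊙α adds b to its first part), so ζ₀(R_α) = M_α by induction on α. Iterating
-- the rule writes each h_β, hence each element of NSym, as a combination of ribbons, so every linear ζ
-- with ζ(R_α) = M_α is ζ₀. Now ζ₀ is multiplicative because β ↦ p_{β₁}⋯p_{βℓ} is, lands in NCSym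
-- because each p_{β₁}⋯p_{βℓ} is homogeneous and invariant under renaming the variables, and is
-- injective because M_α takes the value δ_{αγ} on the word 0^{γ₁} 1^{γ₂} 2^{γ₃} ⋯, which makes the
-- M_α linearly independent.

module Submission where

open import Defs
open import Data.Bool using (Bool; true; false; _∧_; _∨_; not; if_then_else_; T)
import Data.Bool.Properties as BP
open import Data.Bool.ListAction using (all; and)
open import Data.Empty using (⊥-elim)
open import Data.List using (List; []; _∷_; map; length; _++_; concatMap; replicate; take; deduplicate)
import Data.List.Properties as LP
open import Data.List.Extrema.Nat using (max; xs≤max)
open import Data.List.Membership.Propositional using (_∈_)
open import Data.List.Membership.Propositional.Properties
  using (∈-++⁺ˡ; ∈-++⁺ʳ; ∈-map⁺; ∈-concatMap⁺; ∈-deduplicate⁺; ∈-deduplicate⁻)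
open import Data.List.Relation.Unary.All as All using (All; []; _∷_)
import Data.List.Relation.Unary.All.Properties as AllP
open import Data.List.Relation.Unary.AllPairs using ([]; _∷_)
open import Data.List.Relation.Unary.Any as Any using (here; there)
open import Data.List.Relation.Unary.Unique.Propositional using (Unique)
import Data.List.Relation.Unary.Unique.DecPropositional.Properties as UniqueP
open import Data.Maybe using (Maybe; just; nothing; maybe′; _>>=_)
import Data.Maybe as Maybe
open import Data.Nat as ℕ using (ℕ; zero; suc; _≡ᵇ_; _≤_; _<_; z≤n; s≤s; _∸_)
import Data.Nat.Properties as ℕP
open import Data.Nat.ListAction as NL using ()
open import Data.Product using (_×_; Σ; _,_; proj₁; proj₂)
open import Data.Rational using (ℚ; 0ℚ; 1ℚ; _+_; _*_; -_)
import Data.Rational.Properties as QP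
open import Data.Rational.Solver using (module +-*-Solver)
open +-*-Solver using (solve; _:+_; _:*_; :-_; _:=_; con)
open import Data.Sum using (_⊎_; inj₁; inj₂; [_,_]′)
open import Function using (_∘_)
open import Function.Bundles using (Injection)
open import Function.Properties.Inverse using (↔⇒↣)
open import Relation.Binary.Definitions using (tri<; tri≈; tri>)
open import Relation.Binary.PropositionalEquality
open import Relation.Nullary using (Dec; yes; no)

private variable
  ι κ : Set

∑ : List ι → (ι → ℚ) → ℚ
∑ xs f = sumℚ (map f xs)

∑-cong : ∀ xs {f g : ι → ℚ} → (∀ x → f x ≡ g x) → ∑ xs f ≡ ∑ xs g
∑-cong []       f≗g = refl
∑-cong (x ∷ xs) f≗g = cong₂ _+_ (f≗g x) (∑-cong xs f≗g)

∑-cong-∈ : ∀ xs {f g : ι → ℚ} → (∀ {x} → x ∈ xs → f x ≡ g x) → ∑ xs f ≡ ∑ xs g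
∑-cong-∈ []       f≗g = refl
∑-cong-∈ (x ∷ xs) f≗g = cong₂ _+_ (f≗g (here refl)) (∑-cong-∈ xs (f≗g ∘ there))

∑-zero : ∀ xs {f : ι → ℚ} → (∀ {x} → x ∈ xs → f x ≡ 0ℚ) → ∑ xs f ≡ 0ℚ
∑-zero xs {f} f≡0 = trans (∑-cong-∈ xs f≡0) (∑-0 xs)
  where
  ∑-0 : ∀ xs → ∑ xs (λ _ → 0ℚ) ≡ 0ℚ
  ∑-0 []       = refl
  ∑-0 (_ ∷ xs) = trans (QP.+-identityˡ _) (∑-0 xs)

∑-+ : ∀ xs (f g : ι → ℚ) → ∑ xs (λ x → f x + g x) ≡ ∑ xs f + ∑ xs g
∑-+ []       f g = sym (QP.+-identityˡ 0ℚ)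
∑-+ (x ∷ xs) f g = trans (cong (f x + g x +_) (∑-+ xs f g)) (interchange (f x) (g x) _ _)
  where
  interchange : ∀ a b c d → a + b + (c + d) ≡ a + c + (b + d)
  interchange = solve 4 (λ a b c d → a :+ b :+ (c :+ d) := a :+ c :+ (b :+ d)) refl

∑-*ˡ : ∀ xs c (f : ι → ℚ) → ∑ xs (λ x → c * f x) ≡ c * ∑ xs f
∑-*ˡ []       c f = sym (QP.*-zeroʳ c)
∑-*ˡ (x ∷ xs) c f = trans (cong (c * f x +_) (∑-*ˡ xs c f)) (sym (QP.*-distribˡ-+ c (f x) _))

∑-*ʳ : ∀ xs c (f : ι → ℚ) → ∑ xs (λ x → f x * c) ≡ ∑ xs f * c
∑-*ʳ []       c f = sym (QP.*-zeroˡ c)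
∑-*ʳ (x ∷ xs) c f = trans (cong (f x * c +_) (∑-*ʳ xs c f)) (sym (QP.*-distribʳ-+ c (f x) _))

∑-++ : ∀ xs ys (f : ι → ℚ) → ∑ (xs ++ ys) f ≡ ∑ xs f + ∑ ys f
∑-++ []       ys f = sym (QP.+-identityˡ _)
∑-++ (x ∷ xs) ys f = trans (cong (f x +_) (∑-++ xs ys f)) (sym (QP.+-assoc (f x) _ _))

∑-concatMap : ∀ xs (g : ι → List κ) (f : κ → ℚ) →
              ∑ (concatMap g xs) f ≡ ∑ xs (λ x → ∑ (g x) f)
∑-concatMap []       g f = refl
∑-concatMap (x ∷ xs) g f = trans (∑-++ (g x) _ f) (cong (∑ (g x) f +_) (∑-concatMap xs g f))

∑-map : ∀ xs (g : ι → κ) (f : κ → ℚ) → ∑ (map g xs) f ≡ ∑ xs (λ x → f (g x))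
∑-map []       g f = refl
∑-map (x ∷ xs) g f = cong (f (g x) +_) (∑-map xs g f)

∑-comm : ∀ xs (ys : List κ) (f : ι → κ → ℚ) →
         ∑ xs (λ x → ∑ ys (f x)) ≡ ∑ ys (λ y → ∑ xs (λ x → f x y))
∑-comm []       ys f = sym (∑-zero ys (λ _ → refl))
∑-comm (x ∷ xs) ys f =
  trans (cong (∑ ys (f x) +_) (∑-comm xs ys f)) (sym (∑-+ ys (f x) _))

∑-*ʳ-distrib : ∀ xs (f g : ι → ℚ) c → ∑ xs (λ x → f x * g x) * c ≡ ∑ xs (λ x → f x * (g x * c))
∑-*ʳ-distrib xs f g c = trans (sym (∑-*ʳ xs c _)) (∑-cong xs (λ x → QP.*-assoc (f x) (g x) c))

∑-comm-*ˡ : ∀ xs (ys : List κ) (f : κ → ℚ) (g : κ → ι → ℚ) →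
            ∑ xs (λ x → ∑ ys (λ y → f y * g y x)) ≡ ∑ ys (λ y → f y * ∑ xs (g y))
∑-comm-*ˡ xs ys f g = trans (∑-comm xs ys _) (∑-cong ys (λ y → ∑-*ˡ xs (f y) (g y)))

≡ᵇ-refl : ∀ n → (n ≡ᵇ n) ≡ true
≡ᵇ-refl zero    = refl
≡ᵇ-refl (suc n) = ≡ᵇ-refl n

≡ᵇ-≢ : ∀ {m n} → m ≢ n → (m ≡ᵇ n) ≡ false
≡ᵇ-≢ {m} {n} m≢n with m ≡ᵇ n in eq
... | true  = ⊥-elim (m≢n (ℕP.≡ᵇ⇒≡ m n (subst T (sym eq) _)))
... | false = refl

≡ᵇ-+ : ∀ s x y → (s ℕ.+ x ≡ᵇ s ℕ.+ y) ≡ (x ≡ᵇ y)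
≡ᵇ-+ zero    x y = refl
≡ᵇ-+ (suc s) x y = ≡ᵇ-+ s x y

∧-true : ∀ {x y} → x ∧ y ≡ true → x ≡ true × y ≡ true
∧-true {true} {true} _ = refl , refl

true≢false : true ≢ false
true≢false ()

_≟ʷ_ : (u v : Word) → Dec (u ≡ v)
_≟ʷ_ = LP.≡-dec ℕ._≟_

δ : Word → Word → ℚ
δ u v with u ≟ʷ v
... | yes _ = 1ℚ
... | no  _ = 0ℚ

δ-refl : ∀ u → δ u u ≡ 1ℚ
δ-refl u with u ≟ʷ u
... | yes _   = refl
... | no  u≢u = ⊥-elim (u≢u refl)

δ-≢ : ∀ {u v} → u ≢ v → δ u v ≡ 0ℚ
δ-≢ {u} {v} u≢v with u ≟ʷ v
... | yes u≡v = ⊥-elim (u≢v u≡v)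
... | no  _   = refl

δ-sym : ∀ u v → δ u v ≡ δ v u
δ-sym u v with u ≟ʷ v
... | yes refl = sym (δ-refl u)
... | no  u≢v  = sym (δ-≢ (u≢v ∘ sym))

δ-≢0⇒≡ : ∀ {u v} → δ u v ≢ 0ℚ → u ≡ v
δ-≢0⇒≡ {u} {v} δ≢0 with u ≟ʷ v
... | yes u≡v = u≡v
... | no  _   = ⊥-elim (δ≢0 refl)

δ-∷ : ∀ a u v → δ (a ∷ u) (a ∷ v) ≡ δ u v
δ-∷ a u v = by-cases (u ≟ʷ v)
  where
  by-cases : Dec (u ≡ v) → δ (a ∷ u) (a ∷ v) ≡ δ u v
  by-cases (yes refl) = trans (δ-refl (a ∷ u)) (sym (δ-refl u))
  by-cases (no  u≢v)  = trans (δ-≢ {a ∷ u} {a ∷ v} (u≢v ∘ LP.∷-injectiveʳ)) (sym (δ-≢ u≢v))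

δ-∷-≢ : ∀ {a b} u v → a ≢ b → δ (a ∷ u) (b ∷ v) ≡ 0ℚ
δ-∷-≢ {a} {b} u v a≢b = δ-≢ {a ∷ u} {b ∷ v} (a≢b ∘ LP.∷-injectiveˡ)

Covers : (Word → ℚ) → List Word → Set
Covers f L = ∀ w → f w ≢ 0ℚ → w ∈ L

∑-δ : ∀ {L} → Unique L → ∀ {v} → v ∈ L → (f : Word → ℚ) → ∑ L (λ u → δ v u * f u) ≡ f v
∑-δ {x ∷ L} (x∉L ∷ !L) (here refl) f = begin
  δ x x * f x + ∑ L (λ u → δ x u * f u) ≡⟨ cong₂ _+_ (cong (_* f x) (δ-refl x)) rest ⟩
  1ℚ * f x + 0ℚ                         ≡⟨ trans (QP.+-identityʳ _) (QP.*-identityˡ _) ⟩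
  f x                                   ∎
  where
  open ≡-Reasoning
  rest : ∑ L (λ u → δ x u * f u) ≡ 0ℚ
  rest = ∑-zero L (λ {u} u∈L → trans (cong (_* f u) (δ-≢ (All.lookup x∉L u∈L))) (QP.*-zeroˡ (f u)))
∑-δ {x ∷ L} (x∉L ∷ !L) {v} (there v∈L) f = begin
  δ v x * f x + ∑ L (λ u → δ v u * f u) ≡⟨ cong₂ _+_ (cong (_* f x) v≠x) (∑-δ !L v∈L f) ⟩
  0ℚ * f x + f v                        ≡⟨ trans (cong (_+ f v) (QP.*-zeroˡ (f x))) (QP.+-identityˡ _) ⟩
  f v                                   ∎
  where
  open ≡-Reasoning
  v≠x : δ v x ≡ 0ℚ
  v≠x = δ-≢ (λ v≡x → All.lookup x∉L v∈L (sym v≡x))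

∑-δ-covering : ∀ {L} → Unique L → (f : Word → ℚ) → ∀ v → (f v ≢ 0ℚ → v ∈ L) →
               ∑ L (λ u → δ v u * f u) ≡ f v
∑-δ-covering {L} !L f v cover with f v QP.≟ 0ℚ
... | no  fv≢0 = ∑-δ !L (cover fv≢0) f
... | yes fv≡0 = trans (∑-zero L vanish) (sym fv≡0)
  where
  vanish : ∀ {u} → u ∈ L → δ v u * f u ≡ 0ℚ
  vanish {u} _ with v ≟ʷ u
  ... | yes refl = trans (cong (1ℚ *_) fv≡0) (QP.*-zeroʳ 1ℚ)
  ... | no  _    = QP.*-zeroˡ (f u)

∑-covering-unique : ∀ {L₁ L₂} → Unique L₁ → Unique L₂ → (f : Word → ℚ) →
                    Covers f L₁ → Covers f L₂ → ∑ L₁ f ≡ ∑ L₂ f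
∑-covering-unique {L₁} {L₂} !L₁ !L₂ f cover₁ cover₂ = begin
  ∑ L₁ f                                    ≡⟨ ∑-cong L₁ (λ u → sym (∑-δ-covering !L₂ f u (cover₂ u))) ⟩
  ∑ L₁ (λ u → ∑ L₂ (λ v → δ u v * f v))     ≡⟨ ∑-comm L₁ L₂ _ ⟩
  ∑ L₂ (λ v → ∑ L₁ (λ u → δ u v * f v))     ≡⟨ ∑-cong L₂ (λ v → ∑-cong L₁ (λ u → swap u v)) ⟩
  ∑ L₂ (λ v → ∑ L₁ (λ u → δ v u * f u))     ≡⟨ ∑-cong L₂ (λ v → ∑-δ-covering !L₁ f v (cover₁ v)) ⟩
  ∑ L₂ f                                    ∎
  where
  open ≡-Reasoning
  swap : ∀ u v → δ u v * f v ≡ δ v u * f u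
  swap u v = by-cases (u ≟ʷ v)
    where
    by-cases : Dec (u ≡ v) → δ u v * f v ≡ δ v u * f u
    by-cases (yes refl) = refl
    by-cases (no  u≢v)  = begin
      δ u v * f v ≡⟨ cong (_* f v) (δ-≢ u≢v) ⟩
      0ℚ * f v    ≡⟨ QP.*-zeroˡ (f v) ⟩
      0ℚ          ≡⟨ QP.*-zeroˡ (f u) ⟨
      0ℚ * f u    ≡⟨ cong (_* f u) (δ-≢ (u≢v ∘ sym)) ⟨
      δ v u * f u ∎

dedup : List Word → List Word
dedup = deduplicate _≟ʷ_

dedup-unique : ∀ L → Unique (dedup L)
dedup-unique = UniqueP.deduplicate-! _≟ʷ_

covers-dedup : ∀ {f L} → Covers f L → Covers f (dedup L)
covers-dedup cover w ≢0 = ∈-deduplicate⁺ _≟ʷ_ (cover w ≢0)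

covers-++ˡ : ∀ {f L} L′ → Covers f L → Covers f (L ++ L′)
covers-++ˡ L′ cover w ≢0 = ∈-++⁺ˡ (cover w ≢0)

covers-++ʳ : ∀ {f L′} L → Covers f L′ → Covers f (L ++ L′)
covers-++ʳ L cover w ≢0 = ∈-++⁺ʳ L (cover w ≢0)

⋆-∷ : ∀ (f g : Coeffs) a w → (f ⋆ g) (a ∷ w) ≡ f [] * g (a ∷ w) + ((λ u → f (a ∷ u)) ⋆ g) w
⋆-∷ f g a w = cong (f [] * g (a ∷ w) +_) (∑-map (splits w) _ _)

⋆-cong : ∀ {f f′ g g′ : Coeffs} → f ≈ f′ → g ≈ g′ → f ⋆ g ≈ f′ ⋆ g′
⋆-cong f≈f′ g≈g′ w = ∑-cong (splits w) (λ (u , v) → cong₂ _*_ (f≈f′ u) (g≈g′ v))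

⋆-zeroˡ : ∀ f g → (∀ u → f u ≡ 0ℚ) → ∀ w → (f ⋆ g) w ≡ 0ℚ
⋆-zeroˡ f g f≡0 w = ∑-zero (splits w) (λ {(u , v)} _ → trans (cong (_* g v) (f≡0 u)) (QP.*-zeroˡ (g v)))

⋆-∷-[] : ∀ (f g : Coeffs) a w → f [] ≡ 0ℚ → (f ⋆ g) (a ∷ w) ≡ ((λ u → f (a ∷ u)) ⋆ g) w
⋆-∷-[] f g a w f[]≡0 = begin
  (f ⋆ g) (a ∷ w)         ≡⟨ ⋆-∷ f g a w ⟩
  f [] * g (a ∷ w) + rest ≡⟨ cong (λ c → c * g (a ∷ w) + rest) f[]≡0 ⟩
  0ℚ * g (a ∷ w) + rest   ≡⟨ cong (_+ rest) (QP.*-zeroˡ (g (a ∷ w))) ⟩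
  0ℚ + rest               ≡⟨ QP.+-identityˡ rest ⟩
  rest                    ∎
  where
  open ≡-Reasoning
  rest : ℚ
  rest = ((λ u → f (a ∷ u)) ⋆ g) w

⋆-identityˡ : ∀ g → one ⋆ g ≈ g
⋆-identityˡ g []      = trans (QP.+-identityʳ _) (QP.*-identityˡ (g []))
⋆-identityˡ g (a ∷ w) = begin
  (one ⋆ g) (a ∷ w)
    ≡⟨ ⋆-∷ one g a w ⟩
  1ℚ * g (a ∷ w) + ((λ _ → 0ℚ) ⋆ g) w
    ≡⟨ cong₂ _+_ (QP.*-identityˡ (g (a ∷ w))) (⋆-zeroˡ (λ _ → 0ℚ) g (λ _ → refl) w) ⟩
  g (a ∷ w) + 0ℚ
    ≡⟨ QP.+-identityʳ _ ⟩
  g (a ∷ w)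
    ∎
  where open ≡-Reasoning

δ-[] : δ [] ≈ one
δ-[] []      = δ-refl []
δ-[] (_ ∷ _) = refl

δ-∷-[] : ∀ b β → δ (b ∷ β) [] ≡ 0ℚ
δ-∷-[] b β = δ-≢ {b ∷ β} {[]} (λ ())

δ-⋆-δ : ∀ β γ → δ β ⋆ δ γ ≈ δ (β ++ γ)
δ-⋆-δ []      γ w       = trans (⋆-cong δ-[] (λ _ → refl) w) (⋆-identityˡ (δ γ) w)
δ-⋆-δ (b ∷ β) γ []      = begin
  δ (b ∷ β) [] * δ γ [] + 0ℚ ≡⟨ QP.+-identityʳ _ ⟩
  δ (b ∷ β) [] * δ γ []      ≡⟨ cong (_* δ γ []) (δ-∷-[] b β) ⟩
  0ℚ * δ γ []                ≡⟨ QP.*-zeroˡ (δ γ []) ⟩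
  0ℚ                         ≡⟨ δ-∷-[] b (β ++ γ) ⟨
  δ (b ∷ β ++ γ) []          ∎
  where open ≡-Reasoning
δ-⋆-δ (b ∷ β) γ (a ∷ w) = trans (⋆-∷-[] (δ (b ∷ β)) (δ γ) a w (δ-∷-[] b β)) (by-cases (b ℕ.≟ a))
  where
  by-cases : Dec (b ≡ a) → ((λ u → δ (b ∷ β) (a ∷ u)) ⋆ δ γ) w ≡ δ (b ∷ β ++ γ) (a ∷ w)
  by-cases (yes refl) = begin
    ((λ u → δ (b ∷ β) (b ∷ u)) ⋆ δ γ) w ≡⟨ ⋆-cong (δ-∷ b β) (λ _ → refl) w ⟩
    (δ β ⋆ δ γ) w                       ≡⟨ δ-⋆-δ β γ w ⟩
    δ (β ++ γ) w                        ≡⟨ sym (δ-∷ b (β ++ γ) w) ⟩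
    δ (b ∷ β ++ γ) (b ∷ w)              ∎
    where open ≡-Reasoning
  by-cases (no b≢a) =
    trans (⋆-zeroˡ _ (δ γ) (λ u → δ-∷-≢ β u b≢a) w) (sym (δ-∷-≢ (β ++ γ) w b≢a))

linExt : (Word → Coeffs) → List Word → Coeffs → Coeffs
linExt F L f w = ∑ L (λ β → f β * F β w)

linExt-⋆ˡ : ∀ F L f (h : Coeffs) w → (linExt F L f ⋆ h) w ≡ ∑ L (λ β → f β * (F β ⋆ h) w)
linExt-⋆ˡ F L f h w = begin
  ∑ (splits w) (λ (u , v) → ∑ L (λ β → f β * F β u) * h v)
    ≡⟨ ∑-cong (splits w) (λ (u , v) → sym (∑-*ʳ L (h v) _)) ⟩
  ∑ (splits w) (λ (u , v) → ∑ L (λ β → f β * F β u * h v))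
    ≡⟨ ∑-comm (splits w) L _ ⟩
  ∑ L (λ β → ∑ (splits w) (λ (u , v) → f β * F β u * h v))
    ≡⟨ ∑-cong L (λ β → ∑-cong (splits w) (λ (u , v) → QP.*-assoc (f β) _ _)) ⟩
  ∑ L (λ β → ∑ (splits w) (λ (u , v) → f β * (F β u * h v)))
    ≡⟨ ∑-cong L (λ β → ∑-*ˡ (splits w) (f β) _) ⟩
  ∑ L (λ β → f β * (F β ⋆ h) w)
    ∎
  where open ≡-Reasoning

⋆-linExtʳ : ∀ (h : Coeffs) F L f w → (h ⋆ linExt F L f) w ≡ ∑ L (λ β → f β * (h ⋆ F β) w)
⋆-linExtʳ h F L f w = begin
  ∑ (splits w) (λ (u , v) → h u * ∑ L (λ β → f β * F β v))
    ≡⟨ ∑-cong (splits w) (λ (u , v) → sym (∑-*ˡ L (h u) _)) ⟩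
  ∑ (splits w) (λ (u , v) → ∑ L (λ β → h u * (f β * F β v)))
    ≡⟨ ∑-comm (splits w) L _ ⟩
  ∑ L (λ β → ∑ (splits w) (λ (u , v) → h u * (f β * F β v)))
    ≡⟨ ∑-cong L (λ β → ∑-cong (splits w) (λ (u , v) → x*[y*z]≡y*[x*z] (h u) (f β) (F β v))) ⟩
  ∑ L (λ β → ∑ (splits w) (λ (u , v) → f β * (h u * F β v)))
    ≡⟨ ∑-cong L (λ β → ∑-*ˡ (splits w) (f β) _) ⟩
  ∑ L (λ β → f β * (h ⋆ F β) w)
    ∎
  where
  open ≡-Reasoning
  x*[y*z]≡y*[x*z] : ∀ x y z → x * (y * z) ≡ y * (x * z)
  x*[y*z]≡y*[x*z] = solve 3 (λ x y z → x :* (y :* z) := y :* (x :* z)) refl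

linExt-⋆-linExt : ∀ F A f G B g w →
  (linExt F A f ⋆ linExt G B g) w ≡ ∑ A (λ β → f β * ∑ B (λ γ → g γ * (F β ⋆ G γ) w))
linExt-⋆-linExt F A f G B g w =
  trans (linExt-⋆ˡ F A f _ w) (∑-cong A (λ β → cong (f β *_) (⋆-linExtʳ (F β) G B g w)))

linExt-cong : ∀ F L {f g} → f ≈ g → linExt F L f ≈ linExt F L g
linExt-cong F L f≈g w = ∑-cong L (λ β → cong (_* F β w) (f≈g β))

linExt-⊕ : ∀ F L f g → linExt F L (f ⊕ g) ≈ linExt F L f ⊕ linExt F L g
linExt-⊕ F L f g w = trans (∑-cong L (λ β → QP.*-distribʳ-+ (F β w) (f β) (g β))) (∑-+ L _ _)

linExt-· : ∀ F L c f → linExt F L (c · f) ≈ c · linExt F L f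
linExt-· F L c f w = trans (∑-cong L (λ β → QP.*-assoc c (f β) (F β w))) (∑-*ˡ L c _)

linExt-covering-unique : ∀ F {L₁ L₂} → Unique L₁ → Unique L₂ → ∀ f → Covers f L₁ → Covers f L₂ →
                         linExt F L₁ f ≈ linExt F L₂ f
linExt-covering-unique F !L₁ !L₂ f cover₁ cover₂ w =
  ∑-covering-unique !L₁ !L₂ (λ β → f β * F β w) (restrict cover₁) (restrict cover₂)
  where
  restrict : ∀ {L} → Covers f L → Covers (λ β → f β * F β w) L
  restrict cover β ≢0 = cover β (λ fβ≡0 → ≢0 (trans (cong (_* F β w) fβ≡0) (QP.*-zeroˡ (F β w))))

linExt-δ : ∀ {A} → Unique A → ∀ f → Covers f A → linExt δ A f ≈ f
linExt-δ {A} !A f cover v = begin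
  ∑ A (λ β → f β * δ β v) ≡⟨ ∑-cong A (λ β → trans (QP.*-comm (f β) _) (cong (_* f β) (δ-sym β v))) ⟩
  ∑ A (λ β → δ v β * f β) ≡⟨ ∑-δ-covering !A f v (cover v) ⟩
  f v                     ∎
  where open ≡-Reasoning

linExt-⋆ : ∀ F → (∀ β γ → F (β ++ γ) ≈ F β ⋆ F γ) →
           ∀ {A B L} → Unique A → Unique B → Unique L →
           ∀ f g → Covers f A → Covers g B → (∀ {β γ} → β ∈ A → γ ∈ B → β ++ γ ∈ L) →
           linExt F L (f ⋆ g) ≈ linExt F A f ⋆ linExt F B g
linExt-⋆ F F-++ {A} {B} {L} !A !B !L f g coverA coverB ++∈L w = begin
  ∑ L (λ d → (f ⋆ g) d * F d w)
    ≡⟨ ∑-cong L (λ d → cong (_* F d w) (⋆-in-δ d)) ⟩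
  ∑ L (λ d → ∑ A (λ β → f β * ∑ B (λ γ → g γ * δ (β ++ γ) d)) * F d w)
    ≡⟨ ∑-cong L (λ d → trans (∑-*ʳ-distrib A f _ (F d w))
                              (∑-cong A (λ β → cong (f β *_) (∑-*ʳ-distrib B g _ (F d w))))) ⟩
  ∑ L (λ d → ∑ A (λ β → f β * ∑ B (λ γ → g γ * (δ (β ++ γ) d * F d w))))
    ≡⟨ trans (∑-comm-*ˡ L A f _) (∑-cong A (λ β → cong (f β *_) (∑-comm-*ˡ L B g _))) ⟩
  ∑ A (λ β → f β * ∑ B (λ γ → g γ * ∑ L (λ d → δ (β ++ γ) d * F d w)))
    ≡⟨ ∑-cong-∈ A (λ β∈A → cong (f _ *_) (∑-cong-∈ B (λ γ∈B → cong (g _ *_) (sift β∈A γ∈B)))) ⟩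
  ∑ A (λ β → f β * ∑ B (λ γ → g γ * (F β ⋆ F γ) w))
    ≡⟨ sym (linExt-⋆-linExt F A f F B g w) ⟩
  (linExt F A f ⋆ linExt F B g) w
    ∎
  where
  open ≡-Reasoning
  ⋆-in-δ : ∀ d → (f ⋆ g) d ≡ ∑ A (λ β → f β * ∑ B (λ γ → g γ * δ (β ++ γ) d))
  ⋆-in-δ d =
    trans (⋆-cong (λ u → sym (linExt-δ !A f coverA u)) (λ v → sym (linExt-δ !B g coverB v)) d)
    (trans (linExt-⋆-linExt δ A f δ B g d)
           (∑-cong A (λ β → cong (f β *_) (∑-cong B (λ γ → cong (g γ *_) (δ-⋆-δ β γ d))))))
  sift : ∀ {β γ} → β ∈ A → γ ∈ B → ∑ L (λ d → δ (β ++ γ) d * F d w) ≡ (F β ⋆ F γ) w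
  sift {β} {γ} β∈A γ∈B = trans (∑-δ !L (++∈L β∈A γ∈B) (λ d → F d w)) (F-++ β γ w)

dropRun : ℕ → ℕ → Word → Maybe Word
dropRun i zero    w       = just w
dropRun i (suc n) []      = nothing
dropRun i (suc n) (j ∷ w) = if j ≡ᵇ i then dropRun i n w else nothing

-- p⋆ b g = p_b g for the power sum p_b = ∑ᵢ xᵢ^b (which is M (b ∷ [])); p₀ is not
-- of bounded degree, and p⋆ 0 is set to 0.
p⋆ : ℕ → Series → Series
p⋆ zero    g w       = 0ℚ
p⋆ (suc n) g []      = 0ℚ
p⋆ (suc n) g (i ∷ w) = maybe′ g 0ℚ (dropRun i n w)

pProd : Word → Series
pProd []      = one
pProd (b ∷ β) = p⋆ b (pProd β)

maybe′-cong : ∀ {f g : Coeffs} → f ≈ g → ∀ m → maybe′ f 0ℚ m ≡ maybe′ g 0ℚ m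
maybe′-cong f≈g nothing  = refl
maybe′-cong f≈g (just r) = f≈g r

p⋆-cong : ∀ b {f g} → f ≈ g → p⋆ b f ≈ p⋆ b g
p⋆-cong zero    f≈g w       = refl
p⋆-cong (suc n) f≈g []      = refl
p⋆-cong (suc n) f≈g (i ∷ w) = maybe′-cong f≈g (dropRun i n w)

dropRun-⋆ : ∀ i n f g w →
            ((λ u → maybe′ f 0ℚ (dropRun i n u)) ⋆ g) w ≡ maybe′ (f ⋆ g) 0ℚ (dropRun i n w)
dropRun-⋆ i zero    f g w       = refl
dropRun-⋆ i (suc n) f g []      = trans (QP.+-identityʳ _) (QP.*-zeroˡ (g []))
dropRun-⋆ i (suc n) f g (j ∷ w) =
  trans (⋆-∷-[] (λ u → maybe′ f 0ℚ (dropRun i (suc n) u)) g j w refl) (by-cases (j ≡ᵇ i))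
  where
  by-cases : ∀ b → ((λ u → maybe′ f 0ℚ (if b then dropRun i n u else nothing)) ⋆ g) w
                   ≡ maybe′ (f ⋆ g) 0ℚ (if b then dropRun i n w else nothing)
  by-cases true  = dropRun-⋆ i n f g w
  by-cases false = ⋆-zeroˡ _ g (λ _ → refl) w

p⋆-⋆ : ∀ b f g → p⋆ b (f ⋆ g) ≈ p⋆ b f ⋆ g
p⋆-⋆ zero    f g w       = sym (⋆-zeroˡ _ g (λ _ → refl) w)
p⋆-⋆ (suc n) f g []      = sym (trans (QP.+-identityʳ _) (QP.*-zeroˡ (g [])))
p⋆-⋆ (suc n) f g (i ∷ w) = sym (trans (⋆-∷-[] (p⋆ (suc n) f) g i w refl) (dropRun-⋆ i n f g w))

pProd-++ : ∀ β γ → pProd (β ++ γ) ≈ pProd β ⋆ pProd γ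
pProd-++ []      γ w = sym (⋆-identityˡ (pProd γ) w)
pProd-++ (b ∷ β) γ w = trans (p⋆-cong b (pProd-++ β γ) w) (p⋆-⋆ b (pProd β) (pProd γ) w)

dropRun-length : ∀ i n w {r} → dropRun i n w ≡ just r → length w ≡ n ℕ.+ length r
dropRun-length i zero    w       refl = refl
dropRun-length i (suc n) (j ∷ w) eq with j ≡ᵇ i
... | true = cong suc (dropRun-length i n w eq)

pProd-homogeneous : ∀ β w → length w ≢ NL.sum β → pProd β w ≡ 0ℚ
pProd-homogeneous []          []      ≢ = ⊥-elim (≢ refl)
pProd-homogeneous []          (_ ∷ _) ≢ = refl
pProd-homogeneous (zero ∷ β)  w       ≢ = refl
pProd-homogeneous (suc n ∷ β) []      ≢ = refl
pProd-homogeneous (suc n ∷ β) (i ∷ w) ≢ with dropRun i n w in eq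
... | nothing = refl
... | just r  = pProd-homogeneous β r
  (λ |r|≡ → ≢ (cong suc (trans (dropRun-length i n w eq) (cong (n ℕ.+_) |r|≡))))

p⋆-∑ : ∀ b (L : List ι) (F : ι → Coeffs) w → p⋆ b (λ v → ∑ L (λ i → F i v)) w ≡ ∑ L (λ i → p⋆ b (F i) w)
p⋆-∑ zero    L F w       = sym (∑-zero L (λ _ → refl))
p⋆-∑ (suc n) L F []      = sym (∑-zero L (λ _ → refl))
p⋆-∑ (suc n) L F (i ∷ w) with dropRun i n w
... | nothing = sym (∑-zero L (λ _ → refl))
... | just r  = refl

module _ (σ : ℕ → ℕ) (σ-injective : ∀ {x y} → σ x ≡ σ y → x ≡ y) where

  ≡ᵇ-injective : ∀ j i → (σ j ≡ᵇ σ i) ≡ (j ≡ᵇ i)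
  ≡ᵇ-injective j i with j ℕ.≟ i
  ... | yes refl = trans (≡ᵇ-refl (σ j)) (sym (≡ᵇ-refl j))
  ... | no  j≢i  = trans (≡ᵇ-≢ (j≢i ∘ σ-injective)) (sym (≡ᵇ-≢ j≢i))

  dropRun-map : ∀ i n w → dropRun (σ i) n (map σ w) ≡ Maybe.map (map σ) (dropRun i n w)
  dropRun-map i zero    w       = refl
  dropRun-map i (suc n) []      = refl
  dropRun-map i (suc n) (j ∷ w) rewrite ≡ᵇ-injective j i with j ≡ᵇ i
  ... | true  = dropRun-map i n w
  ... | false = refl

  pProd-map : ∀ β w → pProd β (map σ w) ≡ pProd β w
  pProd-map []          []      = refl
  pProd-map []          (_ ∷ _) = refl
  pProd-map (zero ∷ β)  w       = refl
  pProd-map (suc n ∷ β) []      = refl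
  pProd-map (suc n ∷ β) (i ∷ w) rewrite dropRun-map i n w with dropRun i n w
  ... | nothing = refl
  ... | just r  = pProd-map β r

h⋆ : ℕ → Coeffs → Coeffs
h⋆ b f []      = 0ℚ
h⋆ b f (c ∷ w) with c ℕ.≟ b
... | yes _ = f w
... | no  _ = 0ℚ

h⋆-≡ : ∀ b f w → h⋆ b f (b ∷ w) ≡ f w
h⋆-≡ b f w with b ℕ.≟ b
... | yes _   = refl
... | no  b≢b = ⊥-elim (b≢b refl)

h⋆-≢ : ∀ {b c} f w → c ≢ b → h⋆ b f (c ∷ w) ≡ 0ℚ
h⋆-≢ {b} {c} f w c≢b with c ℕ.≟ b
... | yes c≡b = ⊥-elim (c≢b c≡b)
... | no  _   = refl

h⋆-cong : ∀ b {f g} → f ≈ g → h⋆ b f ≈ h⋆ b g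
h⋆-cong b f≈g []      = refl
h⋆-cong b f≈g (c ∷ w) with c ℕ.≟ b
... | yes _ = f≈g w
... | no  _ = refl

h⋆-⋆ : ∀ b f → h⋆ b f ≈ δ (b ∷ []) ⋆ f
h⋆-⋆ b f []      = sym (trans (QP.+-identityʳ _) (trans (cong (_* f []) (δ-∷-[] b [])) (QP.*-zeroˡ (f []))))
h⋆-⋆ b f (c ∷ w) = sym (trans (⋆-∷-[] (δ (b ∷ [])) f c w (δ-∷-[] b [])) (by-cases (c ℕ.≟ b)))
  where
  by-cases : Dec (c ≡ b) → ((λ u → δ (b ∷ []) (c ∷ u)) ⋆ f) w ≡ h⋆ b f (c ∷ w)
  by-cases (yes refl) = trans (⋆-cong (λ u → trans (δ-∷ c [] u) (δ-[] u)) (λ _ → refl) w)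
                              (trans (⋆-identityˡ f w) (sym (h⋆-≡ c f w)))
  by-cases (no c≢b)   = trans (⋆-zeroˡ _ f (λ u → δ-∷-≢ [] u (c≢b ∘ sym)) w) (sym (h⋆-≢ f w c≢b))

h⋆-∑ : ∀ b (L : List ι) (F : ι → Coeffs) w → h⋆ b (λ v → ∑ L (λ i → F i v)) w ≡ ∑ L (λ i → h⋆ b (F i) w)
h⋆-∑ b L F []      = sym (∑-zero L (λ _ → refl))
h⋆-∑ b L F (c ∷ w) with c ℕ.≟ b
... | yes _ = refl
... | no  _ = sym (∑-zero L (λ _ → refl))

δ-∷-h⋆ : ∀ b β → δ (b ∷ β) ≈ h⋆ b (δ β)
δ-∷-h⋆ b β []      = δ-∷-[] b β
δ-∷-h⋆ b β (c ∷ w) with c ℕ.≟ b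
... | yes refl = δ-∷ c β w
... | no  c≢b  = δ-∷-≢ β w (c≢b ∘ sym)

𝟙 : Bool → ℚ
𝟙 b = if b then 1ℚ else 0ℚ

matchAfterRun : Maybe ℕ → ℕ → List ℕ → Maybe Word → Bool
matchAfterRun p i α = maybe′ (λ r → differs p i ∧ matchFrom (just i) α r) false

runOf-∷ : ∀ n i w → runOf (suc n) (i ∷ w) ≡ Maybe.map (i ,_) (dropRun i n w)
runOf-∷ zero    i w       = refl
runOf-∷ (suc n) i []      = refl
runOf-∷ (suc n) i (j ∷ w) with j ≡ᵇ i
... | true  = runOf-∷ n i w
... | false rewrite BP.∧-zeroʳ (length (take n w) ≡ᵇ n) = refl

matchFrom-runOf : ∀ p a α w → matchFrom p (a ∷ α) w
                  ≡ maybe′ (λ (i , r) → differs p i ∧ matchFrom (just i) α r) false (runOf a w)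
matchFrom-runOf p a α w with runOf a w
... | nothing      = refl
... | just (i , r) = refl

matchFrom-∷ : ∀ p n α i w → matchFrom p (suc n ∷ α) (i ∷ w) ≡ matchAfterRun p i α (dropRun i n w)
matchFrom-∷ p n α i w rewrite matchFrom-runOf p (suc n) α (i ∷ w) | runOf-∷ n i w with dropRun i n w
... | nothing = refl
... | just r  = refl

matchFrom-[] : ∀ p a α → matchFrom p (a ∷ α) [] ≡ false
matchFrom-[] p zero    α = refl
matchFrom-[] p (suc a) α = refl

dropRun-+ : ∀ i m n w → dropRun i (m ℕ.+ n) w ≡ (dropRun i m w >>= dropRun i n)
dropRun-+ i zero    n w       = refl
dropRun-+ i (suc m) n []      = refl
dropRun-+ i (suc m) n (j ∷ w) with j ≡ᵇ i
... | true  = dropRun-+ i m n w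
... | false = refl

M-[] : M [] ≈ one
M-[] []      = refl
M-[] (_ ∷ _) = refl

matchAfterRun-repeat : ∀ j α X → matchAfterRun (just j) j α X ≡ false
matchAfterRun-repeat j α nothing  = refl
matchAfterRun-repeat j α (just r) rewrite ≡ᵇ-refl j = refl

matchAfterRun-fresh : ∀ {i j} α X → i ≢ j → matchAfterRun (just i) j α X ≡ matchAfterRun nothing j α X
matchAfterRun-fresh α nothing  i≢j = refl
matchAfterRun-fresh α (just r) i≢j rewrite ≡ᵇ-≢ i≢j = refl

staircase : ℕ → List ℕ → Word
staircase k []      = []
staircase k (g ∷ γ) = replicate g k ++ staircase (suc k) γ

dropRun-replicate : ∀ k g r → dropRun k g (replicate g k ++ r) ≡ just r
dropRun-replicate k zero    r = refl
dropRun-replicate k (suc g) r rewrite ≡ᵇ-refl k = dropRun-replicate k g r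

dropRun-replicate-< : ∀ k a d r → dropRun k a (replicate (suc (a ℕ.+ d)) k ++ r) ≡ just (replicate (suc d) k ++ r)
dropRun-replicate-< k zero    d r = refl
dropRun-replicate-< k (suc a) d r rewrite ≡ᵇ-refl k = dropRun-replicate-< k a d r

dropRun-replicate-> : ∀ k g d r → dropRun k (suc (g ℕ.+ d)) (replicate g k ++ r) ≡ dropRun k (suc d) r
dropRun-replicate-> k zero    d r = refl
dropRun-replicate-> k (suc g) d r rewrite ≡ᵇ-refl k = dropRun-replicate-> k g d r

dropRun-staircase : ∀ k d γ → IsComp γ → dropRun k (suc d) (staircase (suc k) γ) ≡ nothing
dropRun-staircase k d []          _ = refl
dropRun-staircase k d (zero ∷ γ)  (() ∷ _)
dropRun-staircase k d (suc g ∷ γ) _ rewrite ≡ᵇ-≢ {suc k} {k} ℕP.1+n≢n = refl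

differs-suc : ∀ k → differs (just k) (suc k) ≡ true
differs-suc k = cong not (≡ᵇ-≢ {k} {suc k} (ℕP.1+n≢n ∘ sym))

matchFrom-repeat : ∀ k α x → matchFrom (just k) α (k ∷ x) ≡ false
matchFrom-repeat k []          x = refl
matchFrom-repeat k (zero ∷ α)  x = refl
matchFrom-repeat k (suc c ∷ α) x = trans (matchFrom-∷ (just k) c α k x) (matchAfterRun-repeat k α (dropRun k c x))

matchFrom-staircase : ∀ k p γ → IsComp γ → differs p k ≡ true → matchFrom p γ (staircase k γ) ≡ true
matchFrom-staircase k p []          _        _        = refl
matchFrom-staircase k p (zero ∷ γ)  (() ∷ _) _
matchFrom-staircase k p (suc g ∷ γ) (_ ∷ cγ) p≢k
  rewrite matchFrom-∷ p g γ k (replicate g k ++ staircase (suc k) γ)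
        | dropRun-replicate k g (staircase (suc k) γ) | p≢k =
  matchFrom-staircase (suc k) (just k) γ cγ (differs-suc k)

matchFrom-staircase-≢ : ∀ k p α γ → IsComp α → IsComp γ → differs p k ≡ true → α ≢ γ →
                        matchFrom p α (staircase k γ) ≡ false
matchFrom-staircase-≢ k p []          []          _        _        _   α≢γ = ⊥-elim (α≢γ refl)
matchFrom-staircase-≢ k p []          (zero ∷ γ)  _        (() ∷ _) _   _
matchFrom-staircase-≢ k p []          (suc g ∷ γ) _        _        _   _   = refl
matchFrom-staircase-≢ k p (a ∷ α)     []          _        _        _   _   = matchFrom-[] p a α
matchFrom-staircase-≢ k p (zero ∷ α)  (_ ∷ γ)     (() ∷ _) _        _   _
matchFrom-staircase-≢ k p (suc a ∷ α) (zero ∷ γ)  _        (() ∷ _) _   _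
matchFrom-staircase-≢ k p (suc a ∷ α) (suc g ∷ γ) (_ ∷ cα) (_ ∷ cγ) p≢k α≢γ
  rewrite matchFrom-∷ p a α k (replicate g k ++ staircase (suc k) γ) with ℕ.compare a g
... | ℕ.less .a d
  rewrite dropRun-replicate-< k a d (staircase (suc k) γ)
        | matchFrom-repeat k α (replicate d k ++ staircase (suc k) γ) = BP.∧-zeroʳ (differs p k)
... | ℕ.equal .a
  rewrite dropRun-replicate k a (staircase (suc k) γ) | p≢k =
  matchFrom-staircase-≢ (suc k) (just k) α γ cα cγ (differs-suc k) (α≢γ ∘ cong (suc a ∷_))
... | ℕ.greater .g d
  rewrite dropRun-replicate-> k g d (staircase (suc k) γ) | dropRun-staircase k d γ cγ = refl

M-staircase : ∀ α γ → IsComp α → IsComp γ → M α (staircase 0 γ) ≡ δ α γ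
M-staircase α γ cα cγ with α ≟ʷ γ
... | yes refl = cong 𝟙 (matchFrom-staircase 0 nothing α cα refl)
... | no  α≢γ  = cong 𝟙 (matchFrom-staircase-≢ 0 nothing α γ cα cγ refl α≢γ)

-- Pieri rule for the monomial basis

pieri : ℕ → List ℕ → List (List ℕ)
pieri b []      = (b ∷ []) ∷ []
pieri b (a ∷ α) = (b ∷ a ∷ α) ∷ (b ℕ.+ a ∷ α) ∷ []

p⋆-M-[] : ∀ n → p⋆ (suc n) (M []) ≈ M (suc n ∷ [])
p⋆-M-[] n []      = refl
p⋆-M-[] n (i ∷ w) = trans (by-cases (dropRun i n w)) (sym (cong 𝟙 (matchFrom-∷ nothing n [] i w)))
  where
  by-cases : ∀ X → maybe′ (M []) 0ℚ X ≡ 𝟙 (matchAfterRun nothing i [] X)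
  by-cases nothing        = refl
  by-cases (just [])      = refl
  by-cases (just (_ ∷ _)) = refl

p⋆-M-∷ : ∀ n m α → p⋆ (suc n) (M (suc m ∷ α)) ≈ M (suc n ∷ suc m ∷ α) ⊕ M (suc n ℕ.+ suc m ∷ α)
p⋆-M-∷ n m α []      = sym (QP.+-identityˡ 0ℚ)
p⋆-M-∷ n m α (i ∷ w) = begin
  maybe′ (M (suc m ∷ α)) 0ℚ (dropRun i n w)
    ≡⟨ by-cases (dropRun i n w) ⟩
  𝟙 (matchAfterRun nothing i (suc m ∷ α) (dropRun i n w))
    + 𝟙 (matchAfterRun nothing i α (dropRun i n w >>= dropRun i (suc m)))
    ≡⟨ sym (cong₂ _+_ (cong 𝟙 (matchFrom-∷ nothing n (suc m ∷ α) i w)) (cong 𝟙 merged)) ⟩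
  M (suc n ∷ suc m ∷ α) (i ∷ w) + M (suc n ℕ.+ suc m ∷ α) (i ∷ w)
    ∎
  where
  open ≡-Reasoning
  merged : matchFrom nothing (suc n ℕ.+ suc m ∷ α) (i ∷ w)
           ≡ matchAfterRun nothing i α (dropRun i n w >>= dropRun i (suc m))
  merged = trans (matchFrom-∷ nothing (n ℕ.+ suc m) α i w)
                 (cong (matchAfterRun nothing i α) (dropRun-+ i n (suc m) w))
  by-cases : ∀ X → maybe′ (M (suc m ∷ α)) 0ℚ X
                   ≡ 𝟙 (matchAfterRun nothing i (suc m ∷ α) X)
                     + 𝟙 (matchAfterRun nothing i α (X >>= dropRun i (suc m)))
  by-cases nothing        = sym (QP.+-identityˡ 0ℚ)
  by-cases (just [])      = sym (QP.+-identityˡ 0ℚ)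
  by-cases (just (j ∷ r)) with j ℕ.≟ i
  ... | yes refl rewrite ≡ᵇ-refl j = begin
    𝟙 (matchFrom nothing (suc m ∷ α) (j ∷ r))
      ≡⟨ cong 𝟙 (matchFrom-∷ nothing m α j r) ⟩
    𝟙 (matchAfterRun nothing j α (dropRun j m r))
      ≡⟨ sym (QP.+-identityˡ _) ⟩
    0ℚ + 𝟙 (matchAfterRun nothing j α (dropRun j m r))
      ≡⟨ cong (λ b → 𝟙 b + 𝟙 (matchAfterRun nothing j α (dropRun j m r)))
              (sym (trans (matchFrom-∷ (just j) m α j r) (matchAfterRun-repeat j α (dropRun j m r)))) ⟩
    𝟙 (matchFrom (just j) (suc m ∷ α) (j ∷ r)) + 𝟙 (matchAfterRun nothing j α (dropRun j m r))
      ∎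
  ... | no j≢i rewrite ≡ᵇ-≢ j≢i = begin
    𝟙 (matchFrom nothing (suc m ∷ α) (j ∷ r))
      ≡⟨ cong 𝟙 (matchFrom-∷ nothing m α j r) ⟩
    𝟙 (matchAfterRun nothing j α (dropRun j m r))
      ≡⟨ cong 𝟙 (sym (matchAfterRun-fresh α (dropRun j m r) (j≢i ∘ sym))) ⟩
    𝟙 (matchAfterRun (just i) j α (dropRun j m r))
      ≡⟨ cong 𝟙 (sym (matchFrom-∷ (just i) m α j r)) ⟩
    𝟙 (matchFrom (just i) (suc m ∷ α) (j ∷ r))
      ≡⟨ sym (QP.+-identityʳ _) ⟩
    𝟙 (matchFrom (just i) (suc m ∷ α) (j ∷ r)) + 0ℚ
      ∎

p⋆-M : ∀ b α → 1 ≤ b → IsComp α → ∀ w → p⋆ b (M α) w ≡ ∑ (pieri b α) (λ α′ → M α′ w)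
p⋆-M (suc n) []          _ _        w = trans (p⋆-M-[] n w) (sym (QP.+-identityʳ _))
p⋆-M (suc n) (zero ∷ α)  _ (() ∷ _) w
p⋆-M (suc n) (suc m ∷ α) _ _        w =
  trans (p⋆-M-∷ n m α w) (cong (M (suc n ∷ suc m ∷ α) w +_) (sym (QP.+-identityʳ _)))

-- Coarsenings and ribbon coefficients

_⊆ᵇ_ : List ℕ → List ℕ → Bool
xs ⊆ᵇ ys = all (λ x → memB x ys) xs

all-cong-All : ∀ {P : ℕ → Set} {f g : ℕ → Bool} {xs} → All P xs → (∀ {x} → P x → f x ≡ g x) →
               all f xs ≡ all g xs
all-cong-All Pxs f≡g = cong and (LP.map-cong-local (All.map f≡g Pxs))

partialSums-∷ : ∀ b α → partialSums (b ∷ α) ≡ b ∷ map (b ℕ.+_) (partialSums α)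
partialSums-∷ b []      = refl
partialSums-∷ b (a ∷ α) = cong (b ∷_) (begin
  partialSums (b ℕ.+ a ∷ α)                                 ≡⟨ partialSums-∷ (b ℕ.+ a) α ⟩
  b ℕ.+ a ∷ map ((b ℕ.+ a) ℕ.+_) (partialSums α)            ≡⟨ cong (b ℕ.+ a ∷_) shift ⟩
  b ℕ.+ a ∷ map (b ℕ.+_) (map (a ℕ.+_) (partialSums α))     ≡⟨ cong (map (b ℕ.+_)) (partialSums-∷ a α) ⟨
  map (b ℕ.+_) (partialSums (a ∷ α))                        ∎)
  where
  open ≡-Reasoning
  shift : map ((b ℕ.+ a) ℕ.+_) (partialSums α) ≡ map (b ℕ.+_) (map (a ℕ.+_) (partialSums α))
  shift = trans (LP.map-cong (ℕP.+-assoc b a) (partialSums α)) (LP.map-∘ (partialSums α))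

partialSums-≥ : ∀ b α → All (b ≤_) (partialSums (b ∷ α))
partialSums-≥ b α rewrite partialSums-∷ b α =
  ℕP.≤-refl ∷ AllP.map⁺ (All.universal (ℕP.m≤m+n b) (partialSums α))

partialSums-positive : ∀ {γ} → IsComp γ → All (1 ≤_) (partialSums γ)
partialSums-positive []              = []
partialSums-positive {g ∷ γ} (g≥1 ∷ _) = All.map (ℕP.≤-trans g≥1) (partialSums-≥ g γ)

memB-here : ∀ b L → memB b (b ∷ L) ≡ true
memB-here b L rewrite ≡ᵇ-refl b = refl

memB-there : ∀ s b L → s ≢ b → memB s (b ∷ L) ≡ memB s L
memB-there s b L s≢b rewrite ≡ᵇ-≢ s≢b = refl

memB-below : ∀ {b c L} → All (b ≤_) L → c < b → memB c L ≡ false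
memB-below             []           c<b = refl
memB-below {c = c} {x ∷ L} (b≤x ∷ b≤xs) c<b =
  trans (memB-there c x L (ℕP.<⇒≢ (ℕP.<-≤-trans c<b b≤x))) (memB-below b≤xs c<b)

memB-+ : ∀ s x L → memB (s ℕ.+ x) (map (s ℕ.+_) L) ≡ memB x L
memB-+ s x []      = refl
memB-+ s x (y ∷ L) = cong₂ _∨_ (≡ᵇ-+ s x y) (memB-+ s x L)

coarsens-head-∉ : ∀ {α} c γ → memB c (partialSums α) ≡ false → coarsensB α (c ∷ γ) ≡ false
coarsens-head-∉ {α} c γ c∉ = begin
  (Σγ ≡ᵇ Σα) ∧ (partialSums (c ∷ γ) ⊆ᵇ partialSums α)
    ≡⟨ cong (λ L → (Σγ ≡ᵇ Σα) ∧ (L ⊆ᵇ partialSums α)) (partialSums-∷ c γ) ⟩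
  (Σγ ≡ᵇ Σα) ∧ (memB c (partialSums α) ∧ (map (c ℕ.+_) (partialSums γ) ⊆ᵇ partialSums α))
    ≡⟨ cong (λ m → (Σγ ≡ᵇ Σα) ∧ (m ∧ (map (c ℕ.+_) (partialSums γ) ⊆ᵇ partialSums α))) c∉ ⟩
  (Σγ ≡ᵇ Σα) ∧ false
    ≡⟨ BP.∧-zeroʳ _ ⟩
  false
    ∎
  where
  open ≡-Reasoning
  Σγ Σα : ℕ
  Σγ = NL.sum (c ∷ γ)
  Σα = NL.sum α

coarsens-< : ∀ {b c} α γ → c < b → coarsensB (b ∷ α) (c ∷ γ) ≡ false
coarsens-< {b} {c} α γ c<b = coarsens-head-∉ {b ∷ α} c γ (memB-below (partialSums-≥ b α) c<b)

coarsens-[b]-> : ∀ {b c} γ → b < c → coarsensB (b ∷ []) (c ∷ γ) ≡ false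
coarsens-[b]-> {b} {c} γ b<c = coarsens-head-∉ {b ∷ []} c γ (memB-there c b [] (ℕP.>⇒≢ b<c))

coarsens-> : ∀ {b c} a α γ → b < c → coarsensB (b ∷ a ∷ α) (c ∷ γ) ≡ coarsensB (b ℕ.+ a ∷ α) (c ∷ γ)
coarsens-> {b} {c} a α γ b<c = cong₂ _∧_
  (cong (NL.sum (c ∷ γ) ≡ᵇ_) (sym (ℕP.+-assoc b a (NL.sum α))))
  (all-cong-All (partialSums-≥ c γ)
                (λ {s} c≤s → memB-there s b (partialSums (b ℕ.+ a ∷ α)) (ℕP.>⇒≢ (ℕP.<-≤-trans b<c c≤s))))

coarsens-≡ : ∀ b α {γ} → IsComp γ → coarsensB (b ∷ α) (b ∷ γ) ≡ coarsensB α γ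
coarsens-≡ b α {γ} cγ = cong₂ _∧_ (≡ᵇ-+ b (NL.sum γ) (NL.sum α)) (begin
  partialSums (b ∷ γ) ⊆ᵇ partialSums (b ∷ α)
    ≡⟨ cong₂ _⊆ᵇ_ (partialSums-∷ b γ) (partialSums-∷ b α) ⟩
  memB b (b ∷ Pα) ∧ all (λ s → memB s (b ∷ Pα)) (map (b ℕ.+_) Pγ)
    ≡⟨ cong (_∧ all (λ s → memB s (b ∷ Pα)) (map (b ℕ.+_) Pγ)) (memB-here b Pα) ⟩
  all (λ s → memB s (b ∷ Pα)) (map (b ℕ.+_) Pγ)
    ≡⟨ cong and (LP.map-∘ Pγ) ⟨
  all (λ x → memB (b ℕ.+ x) (b ∷ Pα)) Pγ
    ≡⟨ all-cong-All (partialSums-positive cγ) (λ {x} x≥1 → memB-there (b ℕ.+ x) b Pα (ℕP.>⇒≢ (ℕP.m<m+n b x≥1))) ⟩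
  all (λ x → memB (b ℕ.+ x) Pα) Pγ
    ≡⟨ cong and (LP.map-cong (λ x → memB-+ b x (partialSums α)) Pγ) ⟩
  Pγ ⊆ᵇ partialSums α
    ∎)
  where
  open ≡-Reasoning
  Pα Pγ : List ℕ
  Pα = map (b ℕ.+_) (partialSums α)
  Pγ = partialSums γ

coarsens-length : ∀ b α {γ} → IsComp γ → coarsensB (b ∷ α) γ ≡ true → length γ ≤ suc (length α)
coarsens-length b α       {[]}    _          _ = z≤n
coarsens-length b α       {c ∷ γ} (_ ∷ cγ) coarse with ℕP.<-cmp c b
... | tri< c<b _ _ = ⊥-elim (true≢false (trans (sym coarse) (coarsens-< α γ c<b)))
coarsens-length b []      {b ∷ []}    _ _ | tri≈ _ refl _ = s≤s z≤n
coarsens-length b []      {b ∷ c ∷ γ} (_ ∷ cγ) coarse | tri≈ _ refl _ =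
  ⊥-elim (true≢false (trans (sym coarse) (trans (coarsens-≡ b [] cγ) (coarsens-head-∉ {[]} c γ refl))))
coarsens-length b (a ∷ α) {b ∷ γ} (_ ∷ cγ) coarse | tri≈ _ refl _ =
  s≤s (coarsens-length a α cγ (trans (sym (coarsens-≡ b (a ∷ α) cγ)) coarse))
coarsens-length b []      {c ∷ γ} _        coarse | tri> _ _ b<c =
  ⊥-elim (true≢false (trans (sym coarse) (coarsens-[b]-> γ b<c)))
coarsens-length b (a ∷ α) {c ∷ γ} cγ       coarse | tri> _ _ b<c =
  ℕP.m≤n⇒m≤1+n (coarsens-length (b ℕ.+ a) α cγ (trans (sym (coarsens-> a α γ b<c)) coarse))

isCompB⇒IsComp : ∀ γ → isCompB γ ≡ true → IsComp γ
isCompB⇒IsComp []          _  = []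
isCompB⇒IsComp (suc c ∷ γ) cγ = s≤s z≤n ∷ isCompB⇒IsComp γ cγ

signIf : Bool → ℕ → ℚ
signIf x n = if x then sign n else 0ℚ

Rcoeff-∉ : ∀ α γ → coarsensB α γ ≡ false → Rcoeff α γ ≡ 0ℚ
Rcoeff-∉ α γ ¬coarse =
  cong (λ x → signIf x (length α ∸ length γ)) (trans (cong (isCompB γ ∧_) ¬coarse) (BP.∧-zeroʳ _))

Rcoeff-∷-< : ∀ {b c} α γ → c < b → Rcoeff (b ∷ α) (c ∷ γ) ≡ 0ℚ
Rcoeff-∷-< {b} {c} α γ c<b = Rcoeff-∉ (b ∷ α) (c ∷ γ) (coarsens-< α γ c<b)

Rcoeff-∷-≡ : ∀ b α γ → Rcoeff (suc b ∷ α) (suc b ∷ γ) ≡ Rcoeff α γ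
Rcoeff-∷-≡ b α γ with isCompB γ in cγ
... | false = refl
... | true  = cong (λ x → signIf x (length α ∸ length γ)) (coarsens-≡ (suc b) α (isCompB⇒IsComp γ cγ))

-- A coarsening is at most as long as what it coarsens, so here the two signs are opposite.
Rcoeff-∷-> : ∀ {b c} a α γ → b < c → Rcoeff (b ∷ a ∷ α) (c ∷ γ) ≡ - Rcoeff (b ℕ.+ a ∷ α) (c ∷ γ)
Rcoeff-∷-> {b} {c} a α γ b<c = begin
  signIf (isCompB (c ∷ γ) ∧ coarsensB (b ∷ a ∷ α) (c ∷ γ)) (suc (length α) ∸ length γ)
    ≡⟨ cong (λ x → signIf (isCompB (c ∷ γ) ∧ x) (suc (length α) ∸ length γ)) (coarsens-> a α γ b<c) ⟩
  signIf valid (suc (length α) ∸ length γ)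
    ≡⟨ flip-sign valid refl ⟩
  - signIf valid (length α ∸ length γ)
    ∎
  where
  open ≡-Reasoning
  valid : Bool
  valid = isCompB (c ∷ γ) ∧ coarsensB (b ℕ.+ a ∷ α) (c ∷ γ)
  flip-sign : ∀ x → x ≡ valid → signIf x (suc (length α) ∸ length γ) ≡ - signIf x (length α ∸ length γ)
  flip-sign false _      = refl
  flip-sign true  valid≡ = cong sign (ℕP.+-∸-assoc 1 (ℕP.≤-pred |cγ|≤|bα|))
    where
    parts : isCompB (c ∷ γ) ≡ true × coarsensB (b ℕ.+ a ∷ α) (c ∷ γ) ≡ true
    parts = ∧-true (sym valid≡)
    |cγ|≤|bα| : length (c ∷ γ) ≤ suc (length α)
    |cγ|≤|bα| = coarsens-length (b ℕ.+ a) α (isCompB⇒IsComp (c ∷ γ) (proj₁ parts)) (proj₂ parts)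

Rcoeff-[] : Rcoeff [] ≈ one
Rcoeff-[] []      = refl
Rcoeff-[] (c ∷ γ) = Rcoeff-∉ [] (c ∷ γ) (coarsens-head-∉ {[]} c γ refl)

pieri-Rcoeff-< : ∀ {b c} α γ → IsComp α → c < b → ∑ (pieri b α) (λ α′ → Rcoeff α′ (c ∷ γ)) ≡ 0ℚ
pieri-Rcoeff-< []      γ _         c<b = trans (QP.+-identityʳ _) (Rcoeff-∷-< [] γ c<b)
pieri-Rcoeff-< (a ∷ α) γ (a≥1 ∷ _) c<b = trans
  (cong₂ _+_ (Rcoeff-∷-< (a ∷ α) γ c<b)
             (trans (QP.+-identityʳ _) (Rcoeff-∷-< α γ (ℕP.<-≤-trans c<b (ℕP.m≤m+n _ a)))))
  (QP.+-identityʳ 0ℚ)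

pieri-Rcoeff-> : ∀ {b c} α γ → b < c → ∑ (pieri b α) (λ α′ → Rcoeff α′ (c ∷ γ)) ≡ 0ℚ
pieri-Rcoeff-> {b} {c} []      γ b<c =
  trans (QP.+-identityʳ _) (Rcoeff-∉ (b ∷ []) (c ∷ γ) (coarsens-[b]-> γ b<c))
pieri-Rcoeff-> {b} {c} (a ∷ α) γ b<c = begin
  Rcoeff (b ∷ a ∷ α) (c ∷ γ) + (r + 0ℚ) ≡⟨ cong₂ _+_ (Rcoeff-∷-> a α γ b<c) (QP.+-identityʳ r) ⟩
  - r + r                                ≡⟨ QP.+-inverseˡ r ⟩
  0ℚ                                     ∎
  where
  open ≡-Reasoning
  r : ℚ
  r = Rcoeff (b ℕ.+ a ∷ α) (c ∷ γ)

pieri-Rcoeff-≡ : ∀ b α γ → IsComp α → ∑ (pieri (suc b) α) (λ α′ → Rcoeff α′ (suc b ∷ γ)) ≡ Rcoeff α γ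
pieri-Rcoeff-≡ b []      γ _         = trans (QP.+-identityʳ _) (Rcoeff-∷-≡ b [] γ)
pieri-Rcoeff-≡ b (a ∷ α) γ (a≥1 ∷ _) = begin
  Rcoeff (suc b ∷ a ∷ α) (suc b ∷ γ) + (Rcoeff (suc b ℕ.+ a ∷ α) (suc b ∷ γ) + 0ℚ)
    ≡⟨ cong₂ _+_ (Rcoeff-∷-≡ b (a ∷ α) γ) (trans (QP.+-identityʳ _) (Rcoeff-∷-< α γ (ℕP.m<m+n (suc b) a≥1))) ⟩
  Rcoeff (a ∷ α) γ + 0ℚ
    ≡⟨ QP.+-identityʳ _ ⟩
  Rcoeff (a ∷ α) γ
    ∎
  where open ≡-Reasoning

h⋆-Rcoeff : ∀ b α → 1 ≤ b → IsComp α → ∀ γ → h⋆ b (Rcoeff α) γ ≡ ∑ (pieri b α) (λ α′ → Rcoeff α′ γ)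
h⋆-Rcoeff (suc b) []      _ _  []      = refl
h⋆-Rcoeff (suc b) (a ∷ α) _ _  []      = refl
h⋆-Rcoeff (suc b) α       _ cα (c ∷ γ) with ℕP.<-cmp c (suc b)
... | tri< c<b c≢b _   = trans (h⋆-≢ (Rcoeff α) γ c≢b) (sym (pieri-Rcoeff-< α γ cα c<b))
... | tri≈ _   refl _  = trans (h⋆-≡ c (Rcoeff α) γ) (sym (pieri-Rcoeff-≡ b α γ cα))
... | tri> _   c≢b b<c = trans (h⋆-≢ (Rcoeff α) γ c≢b) (sym (pieri-Rcoeff-> α γ b<c))

zeroN : NSym
zeroN = record { coeff = λ _ → 0ℚ ; support = [] ; supportComp = [] ; covers = λ _ ≢0 → ⊥-elim (≢0 refl) }

≢0-+ : ∀ a b → a + b ≢ 0ℚ → a ≢ 0ℚ ⊎ b ≢ 0ℚ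
≢0-+ a b a+b≢0 with a QP.≟ 0ℚ
... | no  a≢0 = inj₁ a≢0
... | yes refl = inj₂ (λ b≡0 → a+b≢0 (trans (QP.+-identityˡ b) b≡0))

infixl 6 _+N_
infixr 7 _·N_

_+N_ : NSym → NSym → NSym
x +N y = record
  { coeff       = coeff x ⊕ coeff y
  ; support     = support x ++ support y
  ; supportComp = AllP.++⁺ (supportComp x) (supportComp y)
  ; covers      = λ w ≢0 → [ ∈-++⁺ˡ ∘ covers x w , ∈-++⁺ʳ (support x) ∘ covers y w ]′ (≢0-+ _ _ ≢0)
  }

_·N_ : ℚ → NSym → NSym
c ·N x = record
  { coeff       = c · coeff x
  ; support     = support x
  ; supportComp = supportComp x
  ; covers      = λ w ≢0 → covers x w (λ x≡0 → ≢0 (trans (cong (c *_) x≡0) (QP.*-zeroʳ c)))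
  }

basisN : (β : Word) → IsComp β → NSym
basisN β cβ = record
  { coeff       = δ β
  ; support     = β ∷ []
  ; supportComp = cβ ∷ []
  ; covers      = λ w ≢0 → here (sym (δ-≢0⇒≡ ≢0))
  }

h⋆N : (b : ℕ) → 1 ≤ b → NSym → NSym
h⋆N b b≥1 x = record
  { coeff       = h⋆ b (coeff x)
  ; support     = map (b ∷_) (support x)
  ; supportComp = AllP.map⁺ (All.map (b≥1 ∷_) (supportComp x))
  ; covers      = cover
  }
  where
  cover : Covers (h⋆ b (coeff x)) (map (b ∷_) (support x))
  cover []      ≢0 = ⊥-elim (≢0 refl)
  cover (c ∷ w) ≢0 with c ℕ.≟ b
  ... | yes refl = ∈-map⁺ (c ∷_) (covers x w ≢0)
  ... | no  _    = ⊥-elim (≢0 refl)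

x+[y+0]-y≡x : ∀ x y → x + (y + 0ℚ) + (- 1ℚ) * y ≡ x
x+[y+0]-y≡x = solve 2 (λ x y → x :+ (y :+ con 0ℚ) :+ (:- con 1ℚ) :* y := x) refl

ribbonN∷ : (b : ℕ) (α : List ℕ) → IsComp (b ∷ α) → NSym
ribbonN∷ b []      (b≥1 ∷ [])       = h⋆N b b≥1 (basisN [] [])
ribbonN∷ b (a ∷ α) (b≥1 ∷ a≥1 ∷ cα) =
  h⋆N b b≥1 (ribbonN∷ a α (a≥1 ∷ cα)) +N ((- 1ℚ) ·N ribbonN∷ (b ℕ.+ a) α (ℕP.≤-trans b≥1 (ℕP.m≤m+n b a) ∷ cα))

ribbonN : (α : List ℕ) → IsComp α → NSym
ribbonN []      _  = basisN [] []
ribbonN (b ∷ α) cα = ribbonN∷ b α cα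

ribbonN∷-coeff : ∀ b α cα → coeff (ribbonN∷ b α cα) ≈ Rcoeff (b ∷ α)
ribbonN∷-coeff b []      (b≥1 ∷ [])       w =
  trans (h⋆-cong b (λ v → trans (δ-[] v) (sym (Rcoeff-[] v))) w)
        (trans (h⋆-Rcoeff b [] b≥1 [] w) (QP.+-identityʳ _))
ribbonN∷-coeff b (a ∷ α) (b≥1 ∷ a≥1 ∷ cα) w = begin
  h⋆ b (coeff (ribbonN∷ a α _)) w + (- 1ℚ) * coeff (ribbonN∷ (b ℕ.+ a) α _) w
    ≡⟨ cong₂ (λ x y → x + (- 1ℚ) * y) (h⋆-cong b (ribbonN∷-coeff a α (a≥1 ∷ cα)) w)
                                       (ribbonN∷-coeff (b ℕ.+ a) α _ w) ⟩
  h⋆ b (Rcoeff (a ∷ α)) w + (- 1ℚ) * Rcoeff (b ℕ.+ a ∷ α) w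
    ≡⟨ cong (_+ (- 1ℚ) * Rcoeff (b ℕ.+ a ∷ α) w) (h⋆-Rcoeff b (a ∷ α) b≥1 (a≥1 ∷ cα) w) ⟩
  Rcoeff (b ∷ a ∷ α) w + (Rcoeff (b ℕ.+ a ∷ α) w + 0ℚ) + (- 1ℚ) * Rcoeff (b ℕ.+ a ∷ α) w
    ≡⟨ x+[y+0]-y≡x (Rcoeff (b ∷ a ∷ α) w) (Rcoeff (b ℕ.+ a ∷ α) w) ⟩
  Rcoeff (b ∷ a ∷ α) w
    ∎
  where open ≡-Reasoning

ribbonN-coeff : ∀ α cα → coeff (ribbonN α cα) ≈ Rcoeff α
ribbonN-coeff []      _  w = trans (δ-[] w) (sym (Rcoeff-[] w))
ribbonN-coeff (b ∷ α) cα   = ribbonN∷-coeff b α cα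

ζ₀ : NSym → Series
ζ₀ x = linExt pProd (dedup (support x)) (coeff x)

ζ₀-via : ∀ x {L} → Covers (coeff x) L → ζ₀ x ≈ linExt pProd (dedup L) (coeff x)
ζ₀-via x {L} cover = linExt-covering-unique pProd (dedup-unique (support x)) (dedup-unique L) (coeff x)
                                            (covers-dedup (covers x)) (covers-dedup cover)

ζ₀-cong : ∀ x y → coeff x ≈ coeff y → ζ₀ x ≈ ζ₀ y
ζ₀-cong x y x≈y w = begin
  ζ₀ x w                    ≡⟨ ζ₀-via x (covers-++ˡ (support y) (covers x)) w ⟩
  linExt pProd L (coeff x) w ≡⟨ linExt-cong pProd L x≈y w ⟩
  linExt pProd L (coeff y) w ≡⟨ ζ₀-via y (covers-++ʳ (support x) (covers y)) w ⟨
  ζ₀ y w                    ∎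
  where
  open ≡-Reasoning
  L : List Word
  L = dedup (support x ++ support y)

ζ₀-+ : ∀ x y z → coeff z ≈ coeff x ⊕ coeff y → ζ₀ z ≈ ζ₀ x ⊕ ζ₀ y
ζ₀-+ x y z z≈x+y w = begin
  ζ₀ z w                                   ≡⟨ ζ₀-via z (covers-++ˡ (support x ++ support y) (covers z)) w ⟩
  linExt pProd L (coeff z) w                ≡⟨ linExt-cong pProd L z≈x+y w ⟩
  linExt pProd L (coeff x ⊕ coeff y) w      ≡⟨ linExt-⊕ pProd L (coeff x) (coeff y) w ⟩
  linExt pProd L (coeff x) w + linExt pProd L (coeff y) w
    ≡⟨ cong₂ _+_ (ζ₀-via x coverˣ w) (ζ₀-via y coverʸ w) ⟨
  ζ₀ x w + ζ₀ y w                           ∎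
  where
  open ≡-Reasoning
  L : List Word
  L = dedup (support z ++ (support x ++ support y))
  coverˣ : Covers (coeff x) (support z ++ (support x ++ support y))
  coverˣ = covers-++ʳ (support z) (covers-++ˡ (support y) (covers x))
  coverʸ : Covers (coeff y) (support z ++ (support x ++ support y))
  coverʸ = covers-++ʳ (support z) (covers-++ʳ (support x) (covers y))

ζ₀-· : ∀ c x z → coeff z ≈ c · coeff x → ζ₀ z ≈ c · ζ₀ x
ζ₀-· c x z z≈cx w = begin
  ζ₀ z w                         ≡⟨ ζ₀-via z (covers-++ˡ (support x) (covers z)) w ⟩
  linExt pProd L (coeff z) w      ≡⟨ linExt-cong pProd L z≈cx w ⟩
  linExt pProd L (c · coeff x) w  ≡⟨ linExt-· pProd L c (coeff x) w ⟩
  c * linExt pProd L (coeff x) w  ≡⟨ cong (c *_) (ζ₀-via x (covers-++ʳ (support z) (covers x)) w) ⟨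
  c * ζ₀ x w                     ∎
  where
  open ≡-Reasoning
  L : List Word
  L = dedup (support z ++ support x)

ζ₀-one : ∀ u → coeff u ≈ one → ζ₀ u ≈ one
ζ₀-one u u≈1 w = begin
  ζ₀ u w                   ≡⟨ ζ₀-via u cover w ⟩
  coeff u [] * one w + 0ℚ  ≡⟨ QP.+-identityʳ _ ⟩
  coeff u [] * one w       ≡⟨ cong (_* one w) (u≈1 []) ⟩
  1ℚ * one w               ≡⟨ QP.*-identityˡ _ ⟩
  one w                    ∎
  where
  open ≡-Reasoning
  cover : Covers (coeff u) ([] ∷ [])
  cover []      _  = here refl
  cover (a ∷ v) ≢0 = ⊥-elim (≢0 (u≈1 (a ∷ v)))

ζ₀-⋆ : ∀ x y z → coeff z ≈ coeff x ⋆ coeff y → ζ₀ z ≈ ζ₀ x ⋆ ζ₀ y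
ζ₀-⋆ x y z z≈xy w = begin
  ζ₀ z w
    ≡⟨ ζ₀-via z (covers-++ˡ products (covers z)) w ⟩
  linExt pProd L (coeff z) w
    ≡⟨ linExt-cong pProd L z≈xy w ⟩
  linExt pProd L (coeff x ⋆ coeff y) w
    ≡⟨ linExt-⋆ pProd pProd-++ (dedup-unique _) (dedup-unique _) (dedup-unique _) (coeff x) (coeff y)
                (covers-dedup (covers x)) (covers-dedup (covers y)) ++∈L w ⟩
  (ζ₀ x ⋆ ζ₀ y) w
    ∎
  where
  open ≡-Reasoning
  Sx Sy products L : List Word
  Sx = dedup (support x)
  Sy = dedup (support y)
  products = concatMap (λ β → map (β ++_) Sy) Sx
  L = dedup (support z ++ products)
  ++∈L : ∀ {β γ} → β ∈ Sx → γ ∈ Sy → β ++ γ ∈ L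
  ++∈L β∈Sx γ∈Sy = ∈-deduplicate⁺ _≟ʷ_ (∈-++⁺ʳ (support z)
    (∈-concatMap⁺ (λ β′ → map (β′ ++_) Sy) (Any.map (λ { refl → ∈-map⁺ (_ ++_) γ∈Sy }) β∈Sx)))

ζ₀-boundedDegree : ∀ x → BoundedDegree (ζ₀ x)
ζ₀-boundedDegree x = max 0 (map NL.sum Sx) , λ w d<|w| →
  ∑-zero Sx (λ {β} β∈Sx → trans (cong (coeff x β *_) (pProd-homogeneous β w (|w|≢ {β} {w} β∈Sx d<|w|)))
                               (QP.*-zeroʳ (coeff x β)))
  where
  Sx : List Word
  Sx = dedup (support x)
  |w|≢ : ∀ {β w} → β ∈ Sx → max 0 (map NL.sum Sx) < length w → length w ≢ NL.sum β
  |w|≢ β∈Sx d<|w| = ℕP.>⇒≢ (ℕP.≤-<-trans (All.lookup (xs≤max 0 (map NL.sum Sx)) (∈-map⁺ NL.sum β∈Sx)) d<|w|)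

ζ₀-permInvariant : ∀ x → PermInvariant (ζ₀ x)
ζ₀-permInvariant x σ w =
  ∑-cong (dedup (support x)) (λ β → cong (coeff x β *_) (pProd-map _ (Injection.injective (↔⇒↣ σ)) β w))

ζ₀-isAlgHom : IsAlgHomToNCSym ζ₀
ζ₀-isAlgHom = (λ x → ζ₀-boundedDegree x , ζ₀-permInvariant x) , ζ₀-one , ζ₀-⋆

ζ₀-basisN : ∀ β cβ → ζ₀ (basisN β cβ) ≈ pProd β
ζ₀-basisN β cβ w = trans (QP.+-identityʳ _) (trans (cong (_* pProd β w) (δ-refl β)) (QP.*-identityˡ _))

ζ₀-h⋆N : ∀ b b≥1 x → ζ₀ (h⋆N b b≥1 x) ≈ p⋆ b (ζ₀ x)
ζ₀-h⋆N b b≥1 x w = begin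
  ζ₀ (h⋆N b b≥1 x) w                       ≡⟨ ζ₀-⋆ [b] x (h⋆N b b≥1 x) (h⋆-⋆ b (coeff x)) w ⟩
  (ζ₀ [b] ⋆ ζ₀ x) w                        ≡⟨ ⋆-cong (ζ₀-basisN (b ∷ []) (b≥1 ∷ [])) (λ _ → refl) w ⟩
  (p⋆ b one ⋆ ζ₀ x) w                      ≡⟨ p⋆-⋆ b one (ζ₀ x) w ⟨
  p⋆ b (one ⋆ ζ₀ x) w                      ≡⟨ p⋆-cong b (⋆-identityˡ (ζ₀ x)) w ⟩
  p⋆ b (ζ₀ x) w                            ∎
  where
  open ≡-Reasoning
  [b] : NSym
  [b] = basisN (b ∷ []) (b≥1 ∷ [])

ζ₀-ribbonN∷ : ∀ b α cα → ζ₀ (ribbonN∷ b α cα) ≈ M (b ∷ α)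
ζ₀-ribbonN∷ b []      (b≥1 ∷ [])       w = begin
  ζ₀ (h⋆N b b≥1 (basisN [] [])) w   ≡⟨ ζ₀-h⋆N b b≥1 (basisN [] []) w ⟩
  p⋆ b (ζ₀ (basisN [] [])) w        ≡⟨ p⋆-cong b (λ v → trans (ζ₀-basisN [] [] v) (sym (M-[] v))) w ⟩
  p⋆ b (M []) w                     ≡⟨ p⋆-M b [] b≥1 [] w ⟩
  M (b ∷ []) w + 0ℚ                 ≡⟨ QP.+-identityʳ _ ⟩
  M (b ∷ []) w                      ∎
  where open ≡-Reasoning
ζ₀-ribbonN∷ b (a ∷ α) (b≥1 ∷ a≥1 ∷ cα) w = begin
  ζ₀ (X +N (- 1ℚ) ·N Y) w
    ≡⟨ ζ₀-+ X ((- 1ℚ) ·N Y) (X +N (- 1ℚ) ·N Y) (λ _ → refl) w ⟩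
  ζ₀ X w + ζ₀ ((- 1ℚ) ·N Y) w
    ≡⟨ cong (ζ₀ X w +_) (ζ₀-· (- 1ℚ) Y ((- 1ℚ) ·N Y) (λ _ → refl) w) ⟩
  ζ₀ X w + (- 1ℚ) * ζ₀ Y w
    ≡⟨ cong₂ (λ x y → x + (- 1ℚ) * y)
             (trans (ζ₀-h⋆N b b≥1 (ribbonN∷ a α (a≥1 ∷ cα)) w) (p⋆-cong b (ζ₀-ribbonN∷ a α (a≥1 ∷ cα)) w))
             (ζ₀-ribbonN∷ (b ℕ.+ a) α (ℕP.≤-trans b≥1 (ℕP.m≤m+n b a) ∷ cα) w) ⟩
  p⋆ b (M (a ∷ α)) w + (- 1ℚ) * M (b ℕ.+ a ∷ α) w
    ≡⟨ cong (_+ (- 1ℚ) * M (b ℕ.+ a ∷ α) w) (p⋆-M b (a ∷ α) b≥1 (a≥1 ∷ cα) w) ⟩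
  M (b ∷ a ∷ α) w + (M (b ℕ.+ a ∷ α) w + 0ℚ) + (- 1ℚ) * M (b ℕ.+ a ∷ α) w
    ≡⟨ x+[y+0]-y≡x (M (b ∷ a ∷ α) w) (M (b ℕ.+ a ∷ α) w) ⟩
  M (b ∷ a ∷ α) w
    ∎
  where
  open ≡-Reasoning
  X Y : NSym
  X = h⋆N b b≥1 (ribbonN∷ a α (a≥1 ∷ cα))
  Y = ribbonN∷ (b ℕ.+ a) α (ℕP.≤-trans b≥1 (ℕP.m≤m+n b a) ∷ cα)

ζ₀-ribbonN : ∀ α cα → ζ₀ (ribbonN α cα) ≈ M α
ζ₀-ribbonN []      _  w = trans (ζ₀-basisN [] [] w) (sym (M-[] w))
ζ₀-ribbonN (b ∷ α) cα   = ζ₀-ribbonN∷ b α cα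

ζ₀-sendsRibbonToM : SendsRibbonToM ζ₀
ζ₀-sendsRibbonToM α cα r r≈R w =
  trans (ζ₀-cong r (ribbonN α cα) (λ v → trans (r≈R v) (sym (ribbonN-coeff α cα v))) w) (ζ₀-ribbonN α cα w)

-- Expanding in ribbons

ribbonsOfH : Word → List Word
ribbonsOfH []      = [] ∷ []
ribbonsOfH (b ∷ β) = concatMap (pieri b) (ribbonsOfH β)

pieri-comp : ∀ {b} α → 1 ≤ b → IsComp α → All IsComp (pieri b α)
pieri-comp []      b≥1 _            = (b≥1 ∷ []) ∷ []
pieri-comp (a ∷ α) b≥1 (a≥1 ∷ cα) = (b≥1 ∷ a≥1 ∷ cα) ∷ (ℕP.≤-trans b≥1 (ℕP.m≤m+n _ a) ∷ cα) ∷ []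

ribbonsOfH-comp : ∀ β → IsComp β → All IsComp (ribbonsOfH β)
ribbonsOfH-comp []      _          = [] ∷ []
ribbonsOfH-comp (b ∷ β) (b≥1 ∷ cβ) =
  AllP.concat⁺ (AllP.map⁺ (All.map (λ {α} → pieri-comp α b≥1) (ribbonsOfH-comp β cβ)))

δ-ribbonsOfH : ∀ β → IsComp β → ∀ γ → δ β γ ≡ ∑ (ribbonsOfH β) (λ α → Rcoeff α γ)
δ-ribbonsOfH []      _          γ = trans (δ-[] γ) (trans (sym (Rcoeff-[] γ)) (sym (QP.+-identityʳ _)))
δ-ribbonsOfH (b ∷ β) (b≥1 ∷ cβ) γ = begin
  δ (b ∷ β) γ                                               ≡⟨ δ-∷-h⋆ b β γ ⟩
  h⋆ b (δ β) γ                                              ≡⟨ h⋆-cong b (δ-ribbonsOfH β cβ) γ ⟩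
  h⋆ b (λ v → ∑ (ribbonsOfH β) (λ α → Rcoeff α v)) γ        ≡⟨ h⋆-∑ b (ribbonsOfH β) Rcoeff γ ⟩
  ∑ (ribbonsOfH β) (λ α → h⋆ b (Rcoeff α) γ)                ≡⟨ ∑-cong-∈ (ribbonsOfH β) pieri-step ⟩
  ∑ (ribbonsOfH β) (λ α → ∑ (pieri b α) (λ α′ → Rcoeff α′ γ)) ≡⟨ ∑-concatMap (ribbonsOfH β) (pieri b) _ ⟨
  ∑ (ribbonsOfH (b ∷ β)) (λ α → Rcoeff α γ)                 ∎
  where
  open ≡-Reasoning
  pieri-step : ∀ {α} → α ∈ ribbonsOfH β → h⋆ b (Rcoeff α) γ ≡ ∑ (pieri b α) (λ α′ → Rcoeff α′ γ)
  pieri-step {α} α∈ = h⋆-Rcoeff b α b≥1 (All.lookup (ribbonsOfH-comp β cβ) α∈) γ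

pProd-ribbonsOfH : ∀ β → IsComp β → ∀ w → pProd β w ≡ ∑ (ribbonsOfH β) (λ α → M α w)
pProd-ribbonsOfH []      _          w = trans (sym (M-[] w)) (sym (QP.+-identityʳ _))
pProd-ribbonsOfH (b ∷ β) (b≥1 ∷ cβ) w = begin
  p⋆ b (pProd β) w                                      ≡⟨ p⋆-cong b (pProd-ribbonsOfH β cβ) w ⟩
  p⋆ b (λ v → ∑ (ribbonsOfH β) (λ α → M α v)) w         ≡⟨ p⋆-∑ b (ribbonsOfH β) M w ⟩
  ∑ (ribbonsOfH β) (λ α → p⋆ b (M α) w)                 ≡⟨ ∑-cong-∈ (ribbonsOfH β) pieri-step ⟩
  ∑ (ribbonsOfH β) (λ α → ∑ (pieri b α) (λ α′ → M α′ w)) ≡⟨ ∑-concatMap (ribbonsOfH β) (pieri b) _ ⟨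
  ∑ (ribbonsOfH (b ∷ β)) (λ α → M α w)                  ∎
  where
  open ≡-Reasoning
  pieri-step : ∀ {α} → α ∈ ribbonsOfH β → p⋆ b (M α) w ≡ ∑ (pieri b α) (λ α′ → M α′ w)
  pieri-step {α} α∈ = p⋆-M b α b≥1 (All.lookup (ribbonsOfH-comp β cβ) α∈) w

Combination : Set
Combination = List (ℚ × Word)

OfCompositions : Combination → Set
OfCompositions = All (IsComp ∘ proj₂)

evalC : Combination → (Word → ℚ) → ℚ
evalC L G = ∑ L (λ (c , α) → c * G α)

ribbonExpansion : NSym → Combination
ribbonExpansion x = concatMap (λ β → map (coeff x β ,_) (ribbonsOfH β)) (dedup (support x))

dedup-support-comp : ∀ x {β} → β ∈ dedup (support x) → IsComp β
dedup-support-comp x β∈ = All.lookup (supportComp x) (∈-deduplicate⁻ _≟ʷ_ (support x) β∈)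

ribbonExpansion-comp : ∀ x → OfCompositions (ribbonExpansion x)
ribbonExpansion-comp x = AllP.concat⁺ (AllP.map⁺ (All.tabulate (λ {β} β∈ →
  AllP.map⁺ (ribbonsOfH-comp β (dedup-support-comp x β∈)))))

evalC-ribbonExpansion : ∀ x G →
  evalC (ribbonExpansion x) G ≡ ∑ (dedup (support x)) (λ β → coeff x β * ∑ (ribbonsOfH β) G)
evalC-ribbonExpansion x G =
  trans (∑-concatMap (dedup (support x)) _ _)
        (∑-cong (dedup (support x)) (λ β → trans (∑-map (ribbonsOfH β) _ _) (∑-*ˡ (ribbonsOfH β) (coeff x β) G)))

coeff-ribbonExpansion : ∀ x γ → coeff x γ ≡ evalC (ribbonExpansion x) (λ α → Rcoeff α γ)
coeff-ribbonExpansion x γ = begin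
  coeff x γ
    ≡⟨ linExt-δ (dedup-unique (support x)) (coeff x) (covers-dedup (covers x)) γ ⟨
  ∑ S (λ β → coeff x β * δ β γ)
    ≡⟨ ∑-cong-∈ S (λ β∈ → cong (coeff x _ *_) (δ-ribbonsOfH _ (dedup-support-comp x β∈) γ)) ⟩
  ∑ S (λ β → coeff x β * ∑ (ribbonsOfH β) (λ α → Rcoeff α γ))
    ≡⟨ evalC-ribbonExpansion x (λ α → Rcoeff α γ) ⟨
  evalC (ribbonExpansion x) (λ α → Rcoeff α γ)
    ∎
  where
  open ≡-Reasoning
  S : List Word
  S = dedup (support x)

ζ₀-ribbonExpansion : ∀ x w → ζ₀ x w ≡ evalC (ribbonExpansion x) (λ α → M α w)
ζ₀-ribbonExpansion x w =
  trans (∑-cong-∈ (dedup (support x))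
                  (λ β∈ → cong (coeff x _ *_) (pProd-ribbonsOfH _ (dedup-support-comp x β∈) w)))
        (sym (evalC-ribbonExpansion x (λ α → M α w)))

-- Evaluating at staircase words reads off the total weight of each α.
M-independent : ∀ L₁ L₂ → OfCompositions L₁ → OfCompositions L₂ →
                (∀ w → evalC L₁ (λ α → M α w) ≡ evalC L₂ (λ α → M α w)) →
                ∀ G → evalC L₁ G ≡ evalC L₂ G
M-independent L₁ L₂ cL₁ cL₂ M₁≡M₂ G = begin
  evalC L₁ G                       ≡⟨ via-weights L₁ (in-A ∘ ∈-++⁺ˡ) ⟩
  ∑ A (λ α′ → weight L₁ α′ * G α′) ≡⟨ ∑-cong-∈ A (λ α′∈ → cong (_* G _) (same-weight α′∈)) ⟩
  ∑ A (λ α′ → weight L₂ α′ * G α′) ≡⟨ via-weights L₂ (in-A ∘ ∈-++⁺ʳ L₁) ⟨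
  evalC L₂ G                       ∎
  where
  open ≡-Reasoning
  A : List Word
  A = dedup (map proj₂ (L₁ ++ L₂))
  weight : Combination → Word → ℚ
  weight L α′ = evalC L (λ α → δ α α′)
  in-A : ∀ {p} → p ∈ L₁ ++ L₂ → proj₂ p ∈ A
  in-A p∈ = ∈-deduplicate⁺ _≟ʷ_ (∈-map⁺ proj₂ p∈)
  via-weights : ∀ L → (∀ {p} → p ∈ L → proj₂ p ∈ A) → evalC L G ≡ ∑ A (λ α′ → weight L α′ * G α′)
  via-weights L ⊆A = begin
    ∑ L (λ (c , α) → c * G α)
      ≡⟨ ∑-cong-∈ L (λ {p} p∈ → cong (proj₁ p *_) (sym (∑-δ (dedup-unique _) (⊆A p∈) G))) ⟩
    ∑ L (λ (c , α) → c * ∑ A (λ α′ → δ α α′ * G α′))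
      ≡⟨ ∑-cong L (λ (c , α) → sym (∑-*ˡ A c _)) ⟩
    ∑ L (λ (c , α) → ∑ A (λ α′ → c * (δ α α′ * G α′)))
      ≡⟨ ∑-comm L A _ ⟩
    ∑ A (λ α′ → ∑ L (λ (c , α) → c * (δ α α′ * G α′)))
      ≡⟨ ∑-cong A (λ α′ → sym (∑-*ʳ-distrib L proj₁ (λ (_ , α) → δ α α′) (G α′))) ⟩
    ∑ A (λ α′ → weight L α′ * G α′)
      ∎
  weight-staircase : ∀ L → OfCompositions L → ∀ {α′} → IsComp α′ →
                     weight L α′ ≡ evalC L (λ α → M α (staircase 0 α′))
  weight-staircase L cL cα′ =
    ∑-cong-∈ L (λ {p} p∈ → cong (proj₁ p *_) (sym (M-staircase _ _ (All.lookup cL p∈) cα′)))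
  comp-A : ∀ {α′} → α′ ∈ A → IsComp α′
  comp-A α′∈ = All.lookup (AllP.map⁺ (AllP.++⁺ cL₁ cL₂)) (∈-deduplicate⁻ _≟ʷ_ _ α′∈)
  same-weight : ∀ {α′} → α′ ∈ A → weight L₁ α′ ≡ weight L₂ α′
  same-weight {α′} α′∈ = trans (weight-staircase L₁ cL₁ (comp-A α′∈))
    (trans (M₁≡M₂ (staircase 0 α′)) (sym (weight-staircase L₂ cL₂ (comp-A α′∈))))

ζ₀-injective : IsInjective ζ₀
ζ₀-injective x y ζ₀x≈ζ₀y γ =
  trans (coeff-ribbonExpansion x γ)
  (trans (M-independent (ribbonExpansion x) (ribbonExpansion y) (ribbonExpansion-comp x) (ribbonExpansion-comp y)
            (λ w → trans (sym (ζ₀-ribbonExpansion x w)) (trans (ζ₀x≈ζ₀y w) (ζ₀-ribbonExpansion y w)))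
            (λ α → Rcoeff α γ))
         (sym (coeff-ribbonExpansion y γ)))

-- Uniqueness of ζ

combinationN : (L : Combination) → OfCompositions L → NSym
combinationN []            _         = zeroN
combinationN ((c , α) ∷ L) (cα ∷ cL) = c ·N ribbonN α cα +N combinationN L cL

combinationN-coeff : ∀ L (cL : OfCompositions L) γ → coeff (combinationN L cL) γ ≡ evalC L (λ α → Rcoeff α γ)
combinationN-coeff []            _         γ = refl
combinationN-coeff ((c , α) ∷ L) (cα ∷ cL) γ =
  cong₂ _+_ (cong (c *_) (ribbonN-coeff α cα γ)) (combinationN-coeff L cL γ)

module _ (ζ : NSym → Series) (ζ-linear : IsLinear ζ) (ζ-R≈M : SendsRibbonToM ζ) where

  ζ-combination : ∀ L (cL : OfCompositions L) z → (∀ γ → coeff z γ ≡ evalC L (λ α → Rcoeff α γ)) →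
                  ∀ w → ζ z w ≡ evalC L (λ α → M α w)
  ζ-combination [] _ z z≈0 w =
    trans (proj₂ ζ-linear 0ℚ z z (λ γ → trans (z≈0 γ) (sym (QP.*-zeroˡ (coeff z γ)))) w) (QP.*-zeroˡ (ζ z w))
  ζ-combination ((c , α) ∷ L) (cα ∷ cL) z z≈ w = begin
    ζ z w                       ≡⟨ proj₁ ζ-linear head rest z split w ⟩
    ζ head w + ζ rest w         ≡⟨ cong₂ _+_ (proj₂ ζ-linear c (ribbonN α cα) head (λ _ → refl) w)
                                             (ζ-combination L cL rest (combinationN-coeff L cL) w) ⟩
    c * ζ (ribbonN α cα) w + evalC L (λ α → M α w)
                                ≡⟨ cong (λ m → c * m + _) (ζ-R≈M α cα (ribbonN α cα) (ribbonN-coeff α cα) w) ⟩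
    c * M α w + evalC L (λ α → M α w) ∎
    where
    open ≡-Reasoning
    head rest : NSym
    head = c ·N ribbonN α cα
    rest = combinationN L cL
    split : coeff z ≈ coeff head ⊕ coeff rest
    split γ = trans (z≈ γ) (sym (combinationN-coeff ((c , α) ∷ L) (cα ∷ cL) γ))

  ζ₀≈ζ : ∀ x → ζ₀ x ≈ ζ x
  ζ₀≈ζ x w = trans (ζ₀-ribbonExpansion x w)
                   (sym (ζ-combination (ribbonExpansion x) (ribbonExpansion-comp x) x (coeff-ribbonExpansion x) w))

IsAlgHomToNCSym-resp : ∀ {ζ ζ′} → (∀ x → ζ x ≈ ζ′ x) → IsAlgHomToNCSym ζ → IsAlgHomToNCSym ζ′
IsAlgHomToNCSym-resp {ζ} {ζ′} ζ≈ζ′ (inNCSym , unit , mult) =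
    (λ x → bounded x (proj₁ (inNCSym x)) , invariant x (proj₂ (inNCSym x)))
  , (λ u u≈1 w → trans (sym (ζ≈ζ′ u w)) (unit u u≈1 w))
  , (λ x y z z≈xy w → trans (sym (ζ≈ζ′ z w))
                      (trans (mult x y z z≈xy w) (⋆-cong (ζ≈ζ′ x) (ζ≈ζ′ y) w)))
  where
  bounded : ∀ x → BoundedDegree (ζ x) → BoundedDegree (ζ′ x)
  bounded x (d , vanish) = d , λ w d<|w| → trans (sym (ζ≈ζ′ x w)) (vanish w d<|w|)
  invariant : ∀ x → PermInvariant (ζ x) → PermInvariant (ζ′ x)
  invariant x inv σ w = trans (sym (ζ≈ζ′ x _)) (trans (inv σ w) (ζ≈ζ′ x w))

IsInjective-resp : ∀ {ζ ζ′} → (∀ x → ζ x ≈ ζ′ x) → IsInjective ζ → IsInjective ζ′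
IsInjective-resp ζ≈ζ′ inj x y ζ′x≈ζ′y = inj x y (λ w → trans (ζ≈ζ′ x w) (trans (ζ′x≈ζ′y w) (sym (ζ≈ζ′ y w))))

mainTheorem17 : Σ (NSym → Series) (λ ζ → IsLinear ζ × SendsRibbonToM ζ)
                × (∀ (ζ : NSym → Series) → IsLinear ζ → SendsRibbonToM ζ
                     → IsAlgHomToNCSym ζ × IsInjective ζ)
mainTheorem17 =
    (ζ₀ , (ζ₀-+ , ζ₀-·) , ζ₀-sendsRibbonToM)
  , λ ζ linear R≈M → IsAlgHomToNCSym-resp (ζ₀≈ζ ζ linear R≈M) ζ₀-isAlgHom
                    , IsInjective-resp (ζ₀≈ζ ζ linear R≈M) ζ₀-injective
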